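{- Let $k\ge 1$ and $n\ge 0$ be integers. The set of $k$-Stirling permutations of size $n+1$ (equivalently, the set of $(k+1)$-ary increasing trees of size $n+1$) is in bijection with the set of path diagrams of length $n$ built on the step vectors $a_1,\dots,a_k,b,c$ with possibility function $\mathrm{pos}(a_{j,\ell})=\binom{k+1}{\ell+1}(j+1)$ for $1\le\ell\le k$, $\mathrm{pos}(b_j)=j+1$, $\mathrm{pos}(c_j)=(k+1)(j+1)$, for all $j\ge 0$.
   Context: A $k$-Stirling permutation of size $m$ is a permutation of the multiset $\{1^k,\dots,m^k\}$ such that for each $i$, all entries between two occurrences of $i$ are at least $i$. A $(k+1)$-ary increasing tree of size $m$ is a rooted tree on nodes $\{1,\dots,m\}$, each node having $k+1$ distinguishable ordered child positions (each occupied or vacant), with labels increasing along paths from the root. Step vectors: rises $a_\ell=(1,\ell)$ for $1\le\ell\le k$, fall $b=(1,-1)$, level $c=(1,0)$. A word $u=u_1\cdots u_n$ over $\{a_1,\dots,a_k,b,c\}$ determines points $M_0=(0,0)$, $M_j=M_{j-1}+u_j$; only paths with all points having nonnegative $y$-coordinate and $M_n=(n,0)$ (i.e. ending at height $0$) are considered. Writing $M_j=(j,y_j)$, the labelled path $\lambda(u)=v_1\cdots v_n$ is defined by $v_j=a_{y_{j-1},\ell}$ if $u_j=a_\ell$, $v_j=b_{y_{j-1}}$ if $u_j=b$, $v_j=c_{y_{j-1}}$ if $u_j=c$. A path diagram of length $n$ with possibility function $\mathrm{pos}$ is a pair $(\lambda(u),s)$ where $\lambda(u)=v_1\cdots v_n$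 is such a labelled path and $s=s_1\cdots s_n$ is a sequence of integers with $0\le s_j<\mathrm{pos}(v_j)$ for all $j$. -}

module Defs where

open import Data.Nat using (ℕ; zero; suc; _+_; _*_; _≤_; _<_)
open import Data.Nat.Combinatorics using (_C_)
open import Data.Fin using (Fin; toℕ)
open import Data.Integer as ℤ using (ℤ; +_; -[1+_]; ∣_∣)
open import Data.List using (List; []; _∷_; length; lookup; concatMap; replicate; map; upTo; scanl; foldr)
open import Data.List.Relation.Binary.Permutation.Propositional using (_↭_)
open import Data.List.Relation.Unary.All using (All)
open import Data.List.Relation.Binary.Pointwise using (Pointwise)
open import Data.Product using (Σ; _×_; _,_; proj₁)
open import Relation.Binary.Bundles using (Setoid)
open import Relation.Binary.PropositionalEquality using (_≡_)
import Relation.Binary.PropositionalEquality as P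
import Relation.Binary.Construct.On as On

multiset : ℕ → ℕ → List ℕ
multiset k m = concatMap (λ i → replicate k i) (map suc (upTo m))

StirlingCondition : List ℕ → Set
StirlingCondition w =
  ∀ (p q r : Fin (length w)) → p Data.Fin.< q → q Data.Fin.< r →
  lookup w p ≡ lookup w r → lookup w p ≤ lookup w q

IsStirlingPerm : ℕ → ℕ → List ℕ → Set
IsStirlingPerm k m w = (w ↭ multiset k m) × StirlingCondition w

StirlingPerm : ℕ → ℕ → Set
StirlingPerm k m = Σ (List ℕ) (IsStirlingPerm k m)

StirlingSetoid : ℕ → ℕ → Setoid _ _
StirlingSetoid k m = On.setoid (P.setoid (List ℕ)) (proj₁ {B = IsStirlingPerm k m})

-- Steps a_ℓ (ℓ = toℕ i + 1, so 1 ≤ ℓ ≤ k), b, c.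
data Step (k : ℕ) : Set where
  a : Fin k → Step k
  b : Step k
  c : Step k

-- y-component of the step vectors: a_ℓ = (1,ℓ), b = (1,-1), c = (1,0).
Δ : ∀ {k} → Step k → ℤ
Δ (a i) = + suc (toℕ i)
Δ b     = -[1+ 0 ]
Δ c     = + 0

heights : ∀ {k} → List (Step k) → List ℤ
heights u = scanl ℤ._+_ (+ 0) (map Δ u)

IsPath : ∀ {k} → List (Step k) → Set
IsPath u = All (ℤ._≤_ (+ 0)) (heights u) × (foldr ℤ._+_ (+ 0) (map Δ u) ≡ + 0)

data Label (k : ℕ) : Set where
  aL : ℕ → Fin k → Label k
  bL : ℕ → Label k
  cL : ℕ → Label k

-- λ(u), started from current height y (the height y_{j-1} before each
-- step; on admissible paths heights are nonnegative, so ∣ y ∣ = y).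
labelFrom : ∀ {k : ℕ} → ℤ → List (Step k) → List (Label k)
labelFrom y []      = []
labelFrom y (a i ∷ u) = aL ∣ y ∣ i ∷ labelFrom (y ℤ.+ Δ (a i)) u
labelFrom y (b ∷ u)   = bL ∣ y ∣   ∷ labelFrom (y ℤ.+ -[1+ 0 ]) u
labelFrom y (c ∷ u)   = cL ∣ y ∣   ∷ labelFrom (y ℤ.+ + 0) u

labelled : ∀ {k} → List (Step k) → List (Label k)
labelled u = labelFrom (+ 0) u

pos : ∀ k → Label k → ℕ
pos k (aL j i) = (suc k C suc (suc (toℕ i))) * suc j
pos k (bL j)   = suc j
pos k (cL j)   = suc k * suc j

-- Data of a path diagram of length n: the path u (determining λ(u)
-- injectively) together with the sequence s.
IsPathDiagram : ∀ k → ℕ → List (Step k) × List ℕ → Set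
IsPathDiagram k n (u , s) =
  length u ≡ n × IsPath u × Pointwise (λ sj vj → sj < pos k vj) s (labelled u)

PathDiagram : ℕ → ℕ → Set
PathDiagram k n = Σ (List (Step k) × List ℕ) (IsPathDiagram k n)

PathDiagramSetoid : ℕ → ℕ → Setoid _ _
PathDiagramSetoid k n =
  On.setoid (P.setoid (List (Step k) × List ℕ)) (proj₁ {B = IsPathDiagram k n})

-- The bijection passes through forests: lists of j + 1 nonempty, pairwise
-- disjoint words avoiding the pattern x y x with y < x, with k copies of each
-- letter v, …, v+m-1 (the words play the role of the subtrees of a (k+1)-ary
-- increasing tree).  Removing the smallest letter v cuts the word containing
-- it at its k copies of v into k + 1 gaps, and the r nonempty gaps replace
-- that word.  This is recorded by which gaps are nonempty (C(k+1, r) choices)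
-- and by the position of the word (j + 1 choices); r = 0, 1, ℓ + 1 give the
-- steps b, c, a_ℓ, and j is the height of the path.  Reading a path diagram
-- backwards therefore inserts the letters one by one (forestOf), and this
-- decoding is injective and onto the forests; the forests at height 0 with
-- letters 1, …, n + 1 are exactly the Stirling permutations.
module Submission where

open import Defs
open import Data.Bool using (Bool; true; false)
open import Data.Empty using (⊥; ⊥-elim)
open import Data.Fin as Fin using (Fin; toℕ; fromℕ<)
open import Data.Fin.Properties using (toℕ-fromℕ<; toℕ-injective)
open import Data.Integer as ℤ using (ℤ; -[1+_])
import Data.Integer.Properties as ℤ
open import Data.List
  using (List; []; _∷_; [_]; _++_; length; replicate; concat; map; take; drop;
         intercalate; filter; lookup; scanl; foldr; upTo; applyUpTo)
open import Data.List.Properties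
  using (length-++; ++-identityʳ; concat-++; filter-++; length-map;
         map-applyUpTo; drop-drop; ∷-injective; filter-none; filter-some; filter-accept; filter-reject)
open import Data.List.Membership.Propositional using (_∈_; _∉_)
open import Data.List.Membership.Propositional.Properties using (∈-++⁻; ∈-++⁺ˡ; ∈-++⁺ʳ; ∈-∃++; ∈-lookup; ∈-concat⁻′)
open import Data.List.Relation.Binary.Disjoint.Propositional using (Disjoint)
import Data.List.Relation.Binary.Disjoint.Propositional.Properties as Disjointₚ
open import Data.List.Relation.Binary.Permutation.Propositional
  using (_↭_; ↭-refl; ↭-sym; ↭-trans; prep)
open import Data.List.Relation.Binary.Permutation.Propositional.Properties
  using (↭-length; filter-↭; shift)
open import Data.List.Relation.Binary.Pointwise using (Pointwise; []; _∷_)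
open import Data.List.Relation.Binary.Sublist.Propositional
  using (_⊆_; []; _∷_; _∷ʳ_; ⊆-refl; ⊆-trans; to∈; from∈)
import Data.List.Relation.Binary.Sublist.Propositional.Properties as Sublist
open import Data.List.Relation.Unary.All as All using (All; []; _∷_)
import Data.List.Relation.Unary.All.Properties as All
open import Data.List.Relation.Unary.AllPairs as AllPairs using (AllPairs; []; _∷_)
import Data.List.Relation.Unary.AllPairs.Properties as AllPairsₚ
open import Data.List.Relation.Unary.Any as Any using (Any; here; there)
open import Data.List.Relation.Unary.Any.Properties using (lookup-index)
open import Data.Nat
  using (ℕ; zero; suc; pred; _+_; _*_; _∸_; _≤_; _<_; _≟_; _≤?_; _<?_; z≤n; s≤s; _/_; _%_)
open import Data.Nat.Properties
open import Data.List.Membership.DecPropositional _≟_ using (_∈?_)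
open import Data.Nat.DivMod using (m≡m%n+[m/n]*n; m%n<n; m<n*o⇒m/o<n; [m+kn]%n≡m%n; m<n⇒m%n≡m)
open import Data.Nat.Combinatorics using (_C_; nCk+nC[k+1]≡[n+1]C[k+1]; nC1≡n)
open import Data.Product using (Σ; ∃; ∃₂; _×_; _,_; proj₁; proj₂; map₁; uncurry)
open import Data.Sum as Sum using (_⊎_; inj₁; inj₂)
open import Function.Base using (_∘_)
open import Function.Bundles using (Bijection; Inverse)
open import Function.Properties.Inverse using (Inverse⇒Bijection)
open import Relation.Nullary using (¬_; yes; no)
open import Relation.Binary.PropositionalEquality hiding ([_]; J)

pat : ℕ → ℕ → List ℕ
pat x y = x ∷ y ∷ x ∷ []

Stirling : List ℕ → Set
Stirling w = ∀ {x y} → y < x → ¬ (pat x y ⊆ w)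

Stirling-⊆ : ∀ {u w} → u ⊆ w → Stirling w → Stirling u
Stirling-⊆ u⊆w st y<x p = st y<x (⊆-trans p u⊆w)

⊆-++⁻ : ∀ {p : List ℕ} u {w} → p ⊆ u ++ w →
  ∃₂ λ p₁ p₂ → p ≡ p₁ ++ p₂ × p₁ ⊆ u × p₂ ⊆ w
⊆-++⁻ [] p⊆w = [] , _ , refl , [] , p⊆w
⊆-++⁻ (x ∷ u) (_ ∷ʳ τ) with ⊆-++⁻ u τ
... | p₁ , p₂ , refl , τ₁ , τ₂ = p₁ , p₂ , refl , x ∷ʳ τ₁ , τ₂
⊆-++⁻ (x ∷ u) (refl ∷ τ) with ⊆-++⁻ u τ
... | p₁ , p₂ , refl , τ₁ , τ₂ = x ∷ p₁ , p₂ , refl , refl ∷ τ₁ , τ₂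

lookup-⊆₂ : ∀ (w : List ℕ) {p q : Fin (length w)} → p Fin.< q → lookup w p ∷ [ lookup w q ] ⊆ w
lookup-⊆₂ (y ∷ w) {Fin.zero}  {Fin.zero}  ()
lookup-⊆₂ (y ∷ w) {Fin.zero}  {Fin.suc q} _ = refl ∷ from∈ (∈-lookup q)
lookup-⊆₂ (y ∷ w) {Fin.suc p} {Fin.zero}  ()
lookup-⊆₂ (y ∷ w) {Fin.suc p} {Fin.suc q} (s≤s p<q) = y ∷ʳ lookup-⊆₂ w p<q

lookup-⊆₃ : ∀ (w : List ℕ) {p q r : Fin (length w)} → p Fin.< q → q Fin.< r →
  lookup w p ∷ lookup w q ∷ [ lookup w r ] ⊆ w
lookup-⊆₃ (y ∷ w) {Fin.zero}  {Fin.zero}  ()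
lookup-⊆₃ (y ∷ w) {Fin.suc p} {Fin.zero}  ()
lookup-⊆₃ (y ∷ w) {Fin.zero}  {Fin.suc q} {Fin.zero}  _ ()
lookup-⊆₃ (y ∷ w) {Fin.zero}  {Fin.suc q} {Fin.suc r} _ (s≤s q<r) = refl ∷ lookup-⊆₂ w q<r
lookup-⊆₃ (y ∷ w) {Fin.suc p} {Fin.suc q} {Fin.zero}  _ ()
lookup-⊆₃ (y ∷ w) {Fin.suc p} {Fin.suc q} {Fin.suc r} (s≤s p<q) (s≤s q<r) =
  y ∷ʳ lookup-⊆₃ w p<q q<r

positions₂ : ∀ {x y : ℕ} w → x ∷ [ y ] ⊆ w →
  ∃₂ λ p q → p Fin.< q × lookup w p ≡ x × lookup w q ≡ y
positions₂ (y ∷ w) (refl ∷ τ) =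
  Fin.zero , Fin.suc (Any.index (to∈ τ)) , s≤s z≤n , refl , sym (lookup-index (to∈ τ))
positions₂ (y ∷ w) (_ ∷ʳ τ) with positions₂ w τ
... | p , q , p<q , eq₁ , eq₂ = Fin.suc p , Fin.suc q , s≤s p<q , eq₁ , eq₂

positions₃ : ∀ {x y z : ℕ} w → x ∷ y ∷ [ z ] ⊆ w →
  ∃₂ λ p q → ∃ λ r → p Fin.< q × q Fin.< r × lookup w p ≡ x × lookup w q ≡ y × lookup w r ≡ z
positions₃ (y ∷ w) (refl ∷ τ) with positions₂ w τ
... | q , r , q<r , eq₂ , eq₃ = Fin.zero , Fin.suc q , Fin.suc r , s≤s z≤n , s≤s q<r , refl , eq₂ , eq₃
positions₃ (y ∷ w) (_ ∷ʳ τ) with positions₃ w τ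
... | p , q , r , p<q , q<r , eq₁ , eq₂ , eq₃ =
  Fin.suc p , Fin.suc q , Fin.suc r , s≤s p<q , s≤s q<r , eq₁ , eq₂ , eq₃

StirlingCondition⇒Stirling : ∀ w → StirlingCondition w → Stirling w
StirlingCondition⇒Stirling w sc y<x τ =
  let p , q , r , p<q , q<r , wp≡x , wq≡y , wr≡x = positions₃ w τ
  in <⇒≱ y<x (subst₂ _≤_ wp≡x wq≡y (sc p q r p<q q<r (trans wp≡x (sym wr≡x))))

Stirling⇒StirlingCondition : ∀ w → Stirling w → StirlingCondition w
Stirling⇒StirlingCondition w st p q r p<q q<r wp≡wr with lookup w p ≤? lookup w q
... | yes wp≤wq = wp≤wq
... | no wp≰wq = ⊥-elim (st (≰⇒> wp≰wq)
        (subst (λ z → lookup w p ∷ lookup w q ∷ [ z ] ⊆ w) (sym wp≡wr) (lookup-⊆₃ w p<q q<r)))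

count : ℕ → List ℕ → ℕ
count x w = length (filter (x ≟_) w)

count-++ : ∀ x u w → count x (u ++ w) ≡ count x u + count x w
count-++ x u w = trans (cong length (filter-++ (x ≟_) u w)) (length-++ (filter (x ≟_) u))

count-∷-≡ : ∀ {x y} w → x ≡ y → count x (y ∷ w) ≡ suc (count x w)
count-∷-≡ {x} {y} w x≡y = cong length (filter-accept (x ≟_) {y} {w} x≡y)

count-∷-≢ : ∀ {x y} w → x ≢ y → count x (y ∷ w) ≡ count x w
count-∷-≢ {x} {y} w x≢y = cong length (filter-reject (x ≟_) {y} {w} x≢y)

count-∷-injective : ∀ {x} y u w → count x (y ∷ u) ≡ count x (y ∷ w) → count x u ≡ count x w
count-∷-injective {x} y u w eq with x ≟ y
... | yes x≡y = suc-injective (trans (sym (count-∷-≡ u x≡y)) (trans eq (count-∷-≡ w x≡y)))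
... | no x≢y = trans (sym (count-∷-≢ u x≢y)) (trans eq (count-∷-≢ w x≢y))

∉⇒count≡0 : ∀ {x} w → x ∉ w → count x w ≡ 0
∉⇒count≡0 {x} w x∉w = cong length (filter-none (x ≟_) (All.¬Any⇒All¬ w x∉w))

∈⇒count≢0 : ∀ {x w} → x ∈ w → count x w ≢ 0
∈⇒count≢0 {x} x∈w c≡0 = <⇒≢ (filter-some (x ≟_) x∈w) (sym c≡0)

count≢0⇒∈ : ∀ {x} w → count x w ≢ 0 → x ∈ w
count≢0⇒∈ {x} w c≢0 with x ∈? w
... | yes x∈w = x∈w
... | no x∉w = ⊥-elim (c≢0 (∉⇒count≡0 w x∉w))

count-replicate-≡ : ∀ m x → count x (replicate m x) ≡ m
count-replicate-≡ zero x = refl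
count-replicate-≡ (suc m) x = trans (count-∷-≡ {x} (replicate m x) refl) (cong suc (count-replicate-≡ m x))

count-replicate-≢ : ∀ m {x y} → x ≢ y → count x (replicate m y) ≡ 0
count-replicate-≢ zero _ = refl
count-replicate-≢ (suc m) x≢y = trans (count-∷-≢ _ x≢y) (count-replicate-≢ m x≢y)

↭⇒count≡ : ∀ {u w} → u ↭ w → ∀ x → count x u ≡ count x w
↭⇒count≡ u↭w x = ↭-length (filter-↭ (x ≟_) u↭w)

count≡⇒↭ : ∀ u w → (∀ x → count x u ≡ count x w) → u ↭ w
count≡⇒↭ [] [] _ = ↭-refl
count≡⇒↭ [] (y ∷ w) same = ⊥-elim (∈⇒count≢0 {y} (here refl) (sym (same y)))
count≡⇒↭ (y ∷ u) w same
  with ∈-∃++ (count≢0⇒∈ {y} w (λ c≡0 → ∈⇒count≢0 {y} (here refl) (trans (same y) c≡0)))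
... | w₁ , w₂ , refl = ↭-trans (prep y (count≡⇒↭ u (w₁ ++ w₂) same′)) (↭-sym (shift y w₁ w₂))
  where
  same′ : ∀ x → count x u ≡ count x (w₁ ++ w₂)
  same′ x = count-∷-injective {x} y u (w₁ ++ w₂) (trans (same x) (↭⇒count≡ (shift y w₁ w₂) x))

record Content (k v m : ℕ) (w : List ℕ) : Set where
  field
    inside : ∀ x → v ≤ x → x < v + m → count x w ≡ k
    below  : ∀ x → x < v → count x w ≡ 0
    above  : ∀ x → v + m ≤ x → count x w ≡ 0

Content-resp : ∀ {k v m u w} → (∀ x → count x u ≡ count x w) → Content k v m u → Content k v m w
Content-resp same cu = record
  { inside = λ x v≤x x< → trans (sym (same x)) (inside x v≤x x<)
  ; below  = λ x x<v → trans (sym (same x)) (below x x<v)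
  ; above  = λ x le → trans (sym (same x)) (above x le)
  }
  where open Content cu

Content-count : ∀ {k v m u w} → Content k v m u → Content k v m w → ∀ x → count x u ≡ count x w
Content-count {v = v} {m} cu cw x with v ≤? x | x <? v + m
... | yes v≤x | yes x<  = trans (Content.inside cu x v≤x x<) (sym (Content.inside cw x v≤x x<))
... | yes _   | no x≮   = trans (Content.above cu x (≮⇒≥ x≮)) (sym (Content.above cw x (≮⇒≥ x≮)))
... | no v≰x  | _       = trans (Content.below cu x (≰⇒> v≰x)) (sym (Content.below cw x (≰⇒> v≰x)))

Content-≥ : ∀ {k v m w x} → Content k v m w → x ∈ w → v ≤ x
Content-≥ {v = v} {x = x} cw x∈w with v ≤? x
... | yes v≤x = v≤x
... | no v≰x = ⊥-elim (∈⇒count≢0 x∈w (Content.below cw x (≰⇒> v≰x)))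

Content-extend : ∀ {k v m u w} → (∀ x → x ≢ v → count x u ≡ count x w) → count v u ≡ k →
  Content k (suc v) m w → Content k v (suc m) u
Content-extend {k} {v} {m} {u} same cv cw = record { inside = inside′ ; below = below′ ; above = above′ }
  where
  open Content cw

  inside′ : ∀ x → v ≤ x → x < v + suc m → count x u ≡ k
  inside′ x v≤x x< with x ≟ v
  ... | yes refl = cv
  ... | no x≢v = trans (same x x≢v)
        (inside x (≤∧≢⇒< v≤x (≢-sym x≢v)) (subst (x <_) (+-suc v m) x<))

  below′ : ∀ x → x < v → count x u ≡ 0
  below′ x x<v = trans (same x (<⇒≢ x<v)) (below x (m<n⇒m<1+n x<v))

  above′ : ∀ x → v + suc m ≤ x → count x u ≡ 0
  above′ x le = trans (same x (≢-sym (<⇒≢ v<x))) (above x (subst (_≤ x) (+-suc v m) le))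
    where
    v<x : v < x
    v<x = <-≤-trans (m<m+n v (s≤s z≤n)) le

Content-shrink : ∀ {k v m u w} → (∀ x → x ≢ v → count x u ≡ count x w) → count v w ≡ 0 →
  Content k v (suc m) u → Content k (suc v) m w
Content-shrink {k} {v} {m} {w = w} same cv cu = record { inside = inside′ ; below = below′ ; above = above′ }
  where
  open Content cu

  inside′ : ∀ x → suc v ≤ x → x < suc v + m → count x w ≡ k
  inside′ x v<x x< = trans (sym (same x (≢-sym (<⇒≢ v<x))))
    (inside x (<⇒≤ v<x) (subst (x <_) (sym (+-suc v m)) x<))

  below′ : ∀ x → x < suc v → count x w ≡ 0
  below′ x x≤v with x ≟ v
  ... | yes refl = cv
  ... | no x≢v = trans (sym (same x x≢v)) (below x (≤∧≢⇒< (≤-pred x≤v) x≢v))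

  above′ : ∀ x → suc v + m ≤ x → count x w ≡ 0
  above′ x le = trans (sym (same x (≢-sym (<⇒≢ v<x)))) (above x (subst (_≤ x) (sym (+-suc v m)) le))
    where
    v<x : v < x
    v<x = ≤-trans (m≤m+n (suc v) m) le

interval : ℕ → ℕ → List ℕ
interval v zero = []
interval v (suc m) = v ∷ interval (suc v) m

Content-interval : ∀ k v m → Content k v m (concat (map (replicate k) (interval v m)))
Content-interval k v zero = record
  { inside = λ x v≤x x<v+0 → ⊥-elim (<⇒≱ x<v+0 (subst (_≤ x) (sym (+-identityʳ v)) v≤x))
  ; below  = λ _ _ → refl
  ; above  = λ _ _ → refl
  }
Content-interval k v (suc m) = Content-extend same copies (Content-interval k (suc v) m)
  where
  rest = concat (map (replicate k) (interval (suc v) m))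

  same : ∀ x → x ≢ v → count x (replicate k v ++ rest) ≡ count x rest
  same x x≢v = trans (count-++ x (replicate k v) rest) (cong (_+ count x rest) (count-replicate-≢ k x≢v))

  copies : count v (replicate k v ++ rest) ≡ k
  copies = trans (count-++ v (replicate k v) rest) (trans
    (cong₂ _+_ (count-replicate-≡ k v) (Content.below (Content-interval k (suc v) m) v (n<1+n v)))
    (+-identityʳ k))

applyUpTo-interval : ∀ (f : ℕ → ℕ) v m → (∀ i → f i ≡ v + i) → applyUpTo f m ≡ interval v m
applyUpTo-interval f v zero _ = refl
applyUpTo-interval f v (suc m) f≗v+ = cong₂ _∷_ (trans (f≗v+ 0) (+-identityʳ v))
  (applyUpTo-interval (λ i → f (suc i)) (suc v) m (λ i → trans (f≗v+ (suc i)) (+-suc v i)))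

Content-multiset : ∀ k m → Content k 1 m (multiset k m)
Content-multiset k m = subst (Content k 1 m) (cong (concat ∘ map (replicate k)) (sym letters))
  (Content-interval k 1 m)
  where
  letters : map suc (upTo m) ≡ interval 1 m
  letters = trans (map-applyUpTo (λ i → i) suc m) (applyUpTo-interval suc 1 m (λ _ → refl))

-- Cutting w at every occurrence of v: w = s₀ v s₁ v ⋯ v sₘ with v ∉ sᵢ.
cut : ℕ → List ℕ → List ℕ × List (List ℕ)
cut v [] = [] , []
cut v (y ∷ w) with y ≟ v
... | yes _ = [] , uncurry _∷_ (cut v w)
... | no _  = map₁ (y ∷_) (cut v w)

factors : ℕ → List ℕ → List (List ℕ)
factors v w = uncurry _∷_ (cut v w)

joinWith : ℕ → List (List ℕ) → List ℕ
joinWith v = intercalate [ v ]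

joinWith-∷ : ∀ v y s ss → joinWith v ((y ∷ s) ∷ ss) ≡ y ∷ joinWith v (s ∷ ss)
joinWith-∷ v y s [] = refl
joinWith-∷ v y s (t ∷ ss) = refl

joinWith-factors : ∀ v w → joinWith v (factors v w) ≡ w
joinWith-factors v [] = refl
joinWith-factors v (y ∷ w) with y ≟ v
... | yes refl = cong (y ∷_) (joinWith-factors v w)
... | no _ = trans (joinWith-∷ v y (proj₁ (cut v w)) (proj₂ (cut v w)))
                   (cong (y ∷_) (joinWith-factors v w))

length-factors : ∀ v w → length (factors v w) ≡ suc (count v w)
length-factors v [] = refl
length-factors v (y ∷ w) with y ≟ v
... | yes refl = trans (cong suc (length-factors y w)) (cong suc (sym (count-∷-≡ w refl)))
... | no y≢v = trans (length-factors v w) (cong suc (sym (count-∷-≢ w (≢-sym y≢v))))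

factors-∉ : ∀ v w → All (v ∉_) (factors v w)
factors-∉ v [] = (λ ()) ∷ []
factors-∉ v (y ∷ w) with y ≟ v
... | yes _ = (λ ()) ∷ factors-∉ v w
... | no y≢v with factors-∉ v w
...   | v∉s ∷ v∉rest = v∉y∷s ∷ v∉rest
  where
  v∉y∷s : v ∉ y ∷ proj₁ (cut v w)
  v∉y∷s (here v≡y) = y≢v (sym v≡y)
  v∉y∷s (there v∈s) = v∉s v∈s

cut-∉ : ∀ {v} s → v ∉ s → cut v s ≡ (s , [])
cut-∉ [] _ = refl
cut-∉ {v} (y ∷ s) v∉y∷s with y ≟ v
... | yes refl = ⊥-elim (v∉y∷s (here refl))
... | no _ = cong (map₁ (y ∷_)) (cut-∉ s (v∉y∷s ∘ there))

cut-sep : ∀ {v} s r → v ∉ s → cut v (s ++ v ∷ r) ≡ (s , factors v r)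
cut-sep {v} [] r _ with v ≟ v
... | yes _ = refl
... | no v≢v = ⊥-elim (v≢v refl)
cut-sep {v} (y ∷ s) r v∉y∷s with y ≟ v
... | yes refl = ⊥-elim (v∉y∷s (here refl))
... | no _ = cong (map₁ (y ∷_)) (cut-sep s r (v∉y∷s ∘ there))

factors-joinWith : ∀ v s ss → All (v ∉_) (s ∷ ss) → factors v (joinWith v (s ∷ ss)) ≡ s ∷ ss
factors-joinWith v s [] (v∉s ∷ []) = cong (uncurry _∷_) (cut-∉ s v∉s)
factors-joinWith v s (t ∷ ss) (v∉s ∷ v∉rest) = cong (uncurry _∷_)
  (trans (cut-sep s _ v∉s) (cong (s ,_) (factors-joinWith v t ss v∉rest)))

joinWith-⊇ : ∀ v ss → All (_⊆ joinWith v ss) ss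
joinWith-⊇ v [] = []
joinWith-⊇ v (s ∷ []) = ⊆-refl ∷ []
joinWith-⊇ v (s ∷ t ∷ ss) = Sublist.++⁺ʳ _ ⊆-refl
  ∷ All.map (λ τ → Sublist.++⁺ˡ s (v ∷ʳ τ)) (joinWith-⊇ v (t ∷ ss))

∈-joinWith⁻ : ∀ {x} v ss → x ∈ joinWith v ss → x ≡ v ⊎ Any (x ∈_) ss
∈-joinWith⁻ v [] ()
∈-joinWith⁻ v (s ∷ []) x∈s = inj₂ (here x∈s)
∈-joinWith⁻ {x} v (s ∷ t ∷ ss) x∈ = step (∈-joinWith⁻ v (t ∷ ss)) (∈-++⁻ s x∈)
  where
  step : (x ∈ joinWith v (t ∷ ss) → x ≡ v ⊎ Any (x ∈_) (t ∷ ss)) →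
         x ∈ s ⊎ x ∈ v ∷ joinWith v (t ∷ ss) → x ≡ v ⊎ Any (x ∈_) (s ∷ t ∷ ss)
  step _  (inj₁ x∈s) = inj₂ (here x∈s)
  step _  (inj₂ (here x≡v)) = inj₁ x≡v
  step ih (inj₂ (there x∈rest)) = Sum.map₂ there (ih x∈rest)

joinWith-pat : ∀ v ss → AllPairs (λ s t → ∀ {x} → x ∈ s → x ∈ t → pat x v ⊆ joinWith v ss) ss
joinWith-pat v [] = []
joinWith-pat v (s ∷ []) = [] ∷ []
joinWith-pat v (s ∷ t ∷ ss) =
  All.map across (joinWith-⊇ v (t ∷ ss)) ∷ AllPairs.map (λ p {_} x∈ x∈′ → widen (p x∈ x∈′)) (joinWith-pat v (t ∷ ss))
  where
  rest = joinWith v (t ∷ ss)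
  widen : ∀ {u} → u ⊆ rest → u ⊆ s ++ v ∷ rest
  widen τ = Sublist.++⁺ˡ s (v ∷ʳ τ)
  across : ∀ {u} → u ⊆ rest → ∀ {x} → x ∈ s → x ∈ u → pat x v ⊆ s ++ v ∷ rest
  across u⊆ x∈s x∈u = Sublist.++⁺ (from∈ x∈s) (refl ∷ from∈ (Sublist.Any-resp-⊆ u⊆ x∈u))

head∈ : ∀ {x : ℕ} {u w} → x ∷ u ⊆ w → x ∈ w
head∈ (refl ∷ _) = here refl
head∈ (_ ∷ʳ τ) = there (head∈ τ)

Stirling-[] : Stirling []
Stirling-[] _ ()

Above : ℕ → List ℕ → Set
Above v s = ∀ {x} → x ∈ s → v < x

Above⇒∉ : ∀ {v s} → Above v s → v ∉ s
Above⇒∉ above v∈s = <-irrefl refl (above v∈s)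

Disjoint-sep : ∀ {v x : ℕ} {s J} → v ∉ s → Disjoint s J → x ∈ s → x ∉ v ∷ J
Disjoint-sep v∉s _ x∈s (here refl) = v∉s x∈s
Disjoint-sep _ s∩J x∈s (there x∈J) = s∩J (x∈s , x∈J)

Stirling-sep : ∀ {v} s J → Stirling s → Stirling J → v ∉ s → (∀ {x} → x ∈ J → v ≤ x) →
  Disjoint s J → Stirling (s ++ v ∷ J)
Stirling-sep {v} s J st-s st-J v∉s J≥v s∩J {x} {y} y<x τ with ⊆-++⁻ s τ
... | [] , _ , refl , _ , refl ∷ τ₂ = <⇒≱ y<x (J≥v (head∈ τ₂))
... | [] , _ , refl , _ , _ ∷ʳ τ₂ = st-J y<x τ₂
... | _ ∷ [] , _ , refl , τ₁ , τ₂ = Disjoint-sep v∉s s∩J (to∈ τ₁) (head∈ (Sublist.∷ˡ⁻ τ₂))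
... | _ ∷ _ ∷ [] , _ , refl , τ₁ , τ₂ = Disjoint-sep v∉s s∩J (head∈ τ₁) (head∈ τ₂)
... | _ ∷ _ ∷ _ ∷ [] , [] , refl , τ₁ , _ = st-s y<x τ₁
... | _ ∷ _ ∷ _ ∷ [] , _ ∷ _ , () , _ , _
... | _ ∷ _ ∷ _ ∷ _ ∷ _ , _ , () , _ , _

Stirling-joinWith : ∀ v ss → All Stirling ss → All (Above v) ss →
  AllPairs Disjoint ss → Stirling (joinWith v ss)
Stirling-joinWith v [] _ _ _ = Stirling-[]
Stirling-joinWith v (s ∷ []) (st ∷ []) _ _ = st
Stirling-joinWith v (s ∷ t ∷ ss) (st ∷ sts) (s>v ∷ rest>v) (s∩rest ∷ disj) =
  Stirling-sep s J st (Stirling-joinWith v (t ∷ ss) sts rest>v disj)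
    (Above⇒∉ s>v) J≥v s∩J
  where
  J = joinWith v (t ∷ ss)
  J≥v : ∀ {x} → x ∈ J → v ≤ x
  J≥v x∈J with ∈-joinWith⁻ v (t ∷ ss) x∈J
  ... | inj₁ refl = ≤-refl
  ... | inj₂ x∈piece = <⇒≤ (uncurry (λ above x∈ → above x∈) (All.lookupAny rest>v x∈piece))
  s∩J : Disjoint s J
  s∩J (x∈s , x∈J) with ∈-joinWith⁻ v (t ∷ ss) x∈J
  ... | inj₁ refl = Above⇒∉ s>v x∈s
  ... | inj₂ x∈piece = uncurry (λ disj x∈ → disj (x∈s , x∈)) (All.lookupAny s∩rest x∈piece)

AllPairs-mapˡ : ∀ {A : Set} {Q : A → Set} {R S : A → A → Set} {xs} →
  (∀ {x y} → Q x → R x y → S x y) → All Q xs → AllPairs R xs → AllPairs S xs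
AllPairs-mapˡ f [] [] = []
AllPairs-mapˡ f (q ∷ qs) (r ∷ rs) = All.map (f q) r ∷ AllPairs-mapˡ f qs rs

-- Conversely, the factors of a Stirling word at its smallest letter v are
-- pairwise disjoint: a shared letter x > v would give the pattern x v x.
factors-disjoint : ∀ v w → Stirling w → (∀ {x} → x ∈ w → v ≤ x) → AllPairs Disjoint (factors v w)
factors-disjoint v w st w≥v = AllPairs-mapˡ noShared (factors-∉ v w)
  (subst (λ u → AllPairs (λ s t → ∀ {x} → x ∈ s → x ∈ t → pat x v ⊆ u) (factors v w))
    (joinWith-factors v w) (joinWith-pat v (factors v w)))
  where
  noShared : ∀ {s t} → v ∉ s → (∀ {x} → x ∈ s → x ∈ t → pat x v ⊆ w) → Disjoint s t
  noShared v∉s xvx⊆w {x} (x∈s , x∈t) = st v<x (xvx⊆w x∈s x∈t)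
    where
    v<x : v < x
    v<x = ≤∧≢⇒< (w≥v (head∈ (xvx⊆w x∈s x∈t))) (λ v≡x → v∉s (subst (_∈ _) (sym v≡x) x∈s))

nonEmpty? : List ℕ → Bool
nonEmpty? [] = false
nonEmpty? (_ ∷ _) = true

NonEmpty : List ℕ → Set
NonEmpty s = nonEmpty? s ≡ true

∈⇒NonEmpty : ∀ {x s} → x ∈ s → NonEmpty s
∈⇒NonEmpty (here _) = refl
∈⇒NonEmpty (there _) = refl

nonEmpties : List (List ℕ) → List (List ℕ)
nonEmpties [] = []
nonEmpties ([] ∷ ss) = nonEmpties ss
nonEmpties ((x ∷ s) ∷ ss) = (x ∷ s) ∷ nonEmpties ss

trues : List Bool → ℕ
trues [] = 0
trues (true ∷ P) = suc (trues P)
trues (false ∷ P) = trues P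

trues≤length : ∀ P → trues P ≤ length P
trues≤length [] = z≤n
trues≤length (true ∷ P) = s≤s (trues≤length P)
trues≤length (false ∷ P) = m≤n⇒m≤1+n (trues≤length P)

scatter : List Bool → List (List ℕ) → List (List ℕ)
scatter [] _ = []
scatter (false ∷ P) xs = [] ∷ scatter P xs
scatter (true ∷ P) [] = [] ∷ scatter P []
scatter (true ∷ P) (x ∷ xs) = x ∷ scatter P xs

scatter-nonEmpties : ∀ ss → scatter (map nonEmpty? ss) (nonEmpties ss) ≡ ss
scatter-nonEmpties [] = refl
scatter-nonEmpties ([] ∷ ss) = cong ([] ∷_) (scatter-nonEmpties ss)
scatter-nonEmpties ((x ∷ s) ∷ ss) = cong ((x ∷ s) ∷_) (scatter-nonEmpties ss)

length-nonEmpties : ∀ ss → length (nonEmpties ss) ≡ trues (map nonEmpty? ss)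
length-nonEmpties [] = refl
length-nonEmpties ([] ∷ ss) = length-nonEmpties ss
length-nonEmpties ((x ∷ s) ∷ ss) = cong suc (length-nonEmpties ss)

nonEmpties-NonEmpty : ∀ ss → All NonEmpty (nonEmpties ss)
nonEmpties-NonEmpty [] = []
nonEmpties-NonEmpty ([] ∷ ss) = nonEmpties-NonEmpty ss
nonEmpties-NonEmpty ((x ∷ s) ∷ ss) = refl ∷ nonEmpties-NonEmpty ss

length-scatter : ∀ P xs → length (scatter P xs) ≡ length P
length-scatter [] xs = refl
length-scatter (false ∷ P) xs = cong suc (length-scatter P xs)
length-scatter (true ∷ P) [] = cong suc (length-scatter P [])
length-scatter (true ∷ P) (x ∷ xs) = cong suc (length-scatter P xs)

shape-scatter : ∀ P xs → length xs ≡ trues P → All NonEmpty xs → map nonEmpty? (scatter P xs) ≡ P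
shape-scatter [] xs _ _ = refl
shape-scatter (false ∷ P) xs len ne = cong (false ∷_) (shape-scatter P xs len ne)
shape-scatter (true ∷ P) ((y ∷ x) ∷ xs) len (_ ∷ ne) =
  cong (true ∷_) (shape-scatter P xs (suc-injective len) ne)

nonEmpties-scatter : ∀ P xs → length xs ≡ trues P → All NonEmpty xs → nonEmpties (scatter P xs) ≡ xs
nonEmpties-scatter [] [] _ _ = refl
nonEmpties-scatter (false ∷ P) xs len ne = nonEmpties-scatter P xs len ne
nonEmpties-scatter (true ∷ P) ((y ∷ x) ∷ xs) len (_ ∷ ne) =
  cong ((y ∷ x) ∷_) (nonEmpties-scatter P xs (suc-injective len) ne)

All-scatter : ∀ {Q : List ℕ → Set} P xs → Q [] → All Q xs → All Q (scatter P xs)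
All-scatter [] xs _ _ = []
All-scatter (false ∷ P) xs q[] qs = q[] ∷ All-scatter P xs q[] qs
All-scatter (true ∷ P) [] q[] qs = q[] ∷ All-scatter P [] q[] qs
All-scatter (true ∷ P) (x ∷ xs) q[] (q ∷ qs) = q ∷ All-scatter P xs q[] qs

AllPairs-scatter : ∀ {R : List ℕ → List ℕ → Set} P xs → (∀ s → R [] s) → (∀ s → R s []) →
  AllPairs R xs → AllPairs R (scatter P xs)
AllPairs-scatter [] xs _ _ _ = []
AllPairs-scatter (false ∷ P) xs R[]s Rs[] rs =
  All.tabulate (λ {s} _ → R[]s s) ∷ AllPairs-scatter P xs R[]s Rs[] rs
AllPairs-scatter (true ∷ P) [] R[]s Rs[] rs =
  All.tabulate (λ {s} _ → R[]s s) ∷ AllPairs-scatter P [] R[]s Rs[] rs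
AllPairs-scatter (true ∷ P) (x ∷ xs) R[]s Rs[] (r ∷ rs) =
  All-scatter P xs (Rs[] x) r ∷ AllPairs-scatter P xs R[]s Rs[] rs

All-nonEmpties : ∀ {Q : List ℕ → Set} ss → All Q ss → All Q (nonEmpties ss)
All-nonEmpties [] _ = []
All-nonEmpties ([] ∷ ss) (_ ∷ qs) = All-nonEmpties ss qs
All-nonEmpties ((x ∷ s) ∷ ss) (q ∷ qs) = q ∷ All-nonEmpties ss qs

AllPairs-nonEmpties : ∀ {R : List ℕ → List ℕ → Set} ss → AllPairs R ss → AllPairs R (nonEmpties ss)
AllPairs-nonEmpties [] _ = []
AllPairs-nonEmpties ([] ∷ ss) (_ ∷ rs) = AllPairs-nonEmpties ss rs
AllPairs-nonEmpties ((x ∷ s) ∷ ss) (r ∷ rs) = All-nonEmpties ss r ∷ AllPairs-nonEmpties ss rs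

Any-scatter⁻ : ∀ {x} P xs → Any (x ∈_) (scatter P xs) → Any (x ∈_) xs
Any-scatter⁻ (false ∷ P) xs (there i) = Any-scatter⁻ P xs i
Any-scatter⁻ (true ∷ P) [] (there i) = Any-scatter⁻ P [] i
Any-scatter⁻ (true ∷ P) (x ∷ xs) (here x∈) = here x∈
Any-scatter⁻ (true ∷ P) (x ∷ xs) (there i) = there (Any-scatter⁻ P xs i)

countAll : ℕ → List (List ℕ) → ℕ
countAll x F = count x (concat F)

countAll-++ : ∀ x F G → countAll x (F ++ G) ≡ countAll x F + countAll x G
countAll-++ x F G = trans (cong (count x) (sym (concat-++ F G))) (count-++ x (concat F) (concat G))

countAll-∷ : ∀ x w F → countAll x (w ∷ F) ≡ count x w + countAll x F
countAll-∷ x w F = count-++ x w (concat F)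

countAll-[_] : ∀ x w → countAll x [ w ] ≡ count x w
countAll-[_] x w = trans (countAll-∷ x w []) (+-identityʳ _)

countAll-scatter : ∀ x P xs → length xs ≡ trues P → countAll x (scatter P xs) ≡ countAll x xs
countAll-scatter x [] [] _ = refl
countAll-scatter x (false ∷ P) xs len = countAll-scatter x P xs len
countAll-scatter x (true ∷ P) (s ∷ xs) len = begin
  countAll x (s ∷ scatter P xs)    ≡⟨ countAll-∷ x s (scatter P xs) ⟩
  count x s + countAll x (scatter P xs) ≡⟨ cong (count x s +_) (countAll-scatter x P xs (suc-injective len)) ⟩
  count x s + countAll x xs        ≡⟨ countAll-∷ x s xs ⟨
  countAll x (s ∷ xs)              ∎
  where open ≡-Reasoning

countAll-∉ : ∀ {x} F → All (x ∉_) F → countAll x F ≡ 0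
countAll-∉ [] [] = refl
countAll-∉ {x} (w ∷ F) (x∉w ∷ x∉F) =
  trans (countAll-∷ x w F) (cong₂ _+_ (∉⇒count≡0 w x∉w) (countAll-∉ F x∉F))

count-joinWith-≢ : ∀ {x v} ss → x ≢ v → count x (joinWith v ss) ≡ countAll x ss
count-joinWith-≢ [] _ = refl
count-joinWith-≢ {x} (s ∷ []) _ = sym (countAll-[ x ] s)
count-joinWith-≢ {x} {v} (s ∷ t ∷ ss) x≢v = begin
  count x (s ++ v ∷ J)         ≡⟨ count-++ x s (v ∷ J) ⟩
  count x s + count x (v ∷ J)  ≡⟨ cong (count x s +_) (count-∷-≢ J x≢v) ⟩
  count x s + count x J        ≡⟨ cong (count x s +_) (count-joinWith-≢ (t ∷ ss) x≢v) ⟩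
  count x s + countAll x (t ∷ ss) ≡⟨ countAll-∷ x s (t ∷ ss) ⟨
  countAll x (s ∷ t ∷ ss)      ∎
  where
  open ≡-Reasoning
  J = joinWith v (t ∷ ss)

count-joinWith-≡ : ∀ v ss → count v (joinWith v ss) ≡ countAll v ss + pred (length ss)
count-joinWith-≡ v [] = refl
count-joinWith-≡ v (s ∷ []) = trans (sym (countAll-[ v ] s)) (sym (+-identityʳ _))
count-joinWith-≡ v (s ∷ t ∷ ss) = begin
  count v (s ++ v ∷ J)                      ≡⟨ count-++ v s (v ∷ J) ⟩
  count v s + count v (v ∷ J)               ≡⟨ cong (count v s +_) (count-∷-≡ J refl) ⟩
  count v s + suc (count v J)               ≡⟨ cong (λ n → count v s + suc n) (count-joinWith-≡ v (t ∷ ss)) ⟩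
  count v s + suc (countAll v (t ∷ ss) + length ss) ≡⟨ cong (count v s +_) (+-suc _ _) ⟨
  count v s + (countAll v (t ∷ ss) + suc (length ss)) ≡⟨ +-assoc (count v s) _ _ ⟨
  count v s + countAll v (t ∷ ss) + suc (length ss) ≡⟨ cong (_+ suc (length ss)) (countAll-∷ v s (t ∷ ss)) ⟨
  countAll v (s ∷ t ∷ ss) + suc (length ss)  ∎
  where
  open ≡-Reasoning
  J = joinWith v (t ∷ ss)

-- Pascal's recursion for binomial coefficients, convenient for recursion on
-- Boolean words; it agrees with the library's n C r.
binom : ℕ → ℕ → ℕ
binom _ zero = 1
binom zero (suc r) = 0
binom (suc n) (suc r) = binom n r + binom n (suc r)

binom≡C : ∀ n r → binom n r ≡ n C r
binom≡C n zero = refl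
binom≡C zero (suc r) = refl
binom≡C (suc n) (suc r) =
  trans (cong₂ _+_ (binom≡C n r) (binom≡C n (suc r))) (nCk+nC[k+1]≡[n+1]C[k+1] n r)

-- Boolean words of length n with r entries true are ranked 0, …, binom n r - 1,
-- those starting with true coming first.  unrank and rank are inverse.
unrank : ℕ → ℕ → ℕ → List Bool
unrank zero r x = []
unrank (suc n) zero x = false ∷ unrank n zero x
unrank (suc n) (suc r) x with x <? binom n r
... | yes _ = true ∷ unrank n r x
... | no _  = false ∷ unrank n (suc r) (x ∸ binom n r)

-- The number of words of length n + 1 with r entries true starting with true.
startingTrue : ℕ → ℕ → ℕ
startingTrue n zero = 0
startingTrue n (suc r) = binom n r

rank : List Bool → ℕ
rank [] = 0
rank (true ∷ P) = rank P
rank (false ∷ P) = startingTrue (length P) (trues P) + rank P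

∸-< : ∀ {x m n} → ¬ x < m → x < m + n → x ∸ m < n
∸-< {x} {m} {n} x≮m x<m+n = subst (x ∸ m <_) (m+n∸m≡n m n) (∸-monoˡ-< x<m+n (≮⇒≥ x≮m))

length-unrank : ∀ n r x → length (unrank n r x) ≡ n
length-unrank zero r x = refl
length-unrank (suc n) zero x = cong suc (length-unrank n zero x)
length-unrank (suc n) (suc r) x with x <? binom n r
... | yes _ = cong suc (length-unrank n r x)
... | no _  = cong suc (length-unrank n (suc r) (x ∸ binom n r))

trues-unrank : ∀ n r x → x < binom n r → trues (unrank n r x) ≡ r
trues-unrank zero zero x _ = refl
trues-unrank (suc n) zero x x< = trues-unrank n zero x x<
trues-unrank (suc n) (suc r) x x< with x <? binom n r
... | yes x<′ = cong suc (trues-unrank n r x x<′)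
... | no x≮  = trues-unrank n (suc r) (x ∸ binom n r) (∸-< x≮ x<)

rank-unrank : ∀ n r x → x < binom n r → rank (unrank n r x) ≡ x
rank-unrank zero zero zero _ = refl
rank-unrank zero zero (suc x) (s≤s ())
rank-unrank (suc n) zero x x< rewrite trues-unrank n zero x x< = rank-unrank n zero x x<
rank-unrank (suc n) (suc r) x x< with x <? binom n r
... | yes x<′ = rank-unrank n r x x<′
... | no x≮ rewrite trues-unrank n (suc r) (x ∸ binom n r) (∸-< x≮ x<)
                  | length-unrank n (suc r) (x ∸ binom n r)
                  | rank-unrank n (suc r) (x ∸ binom n r) (∸-< x≮ x<) = m+[n∸m]≡n (≮⇒≥ x≮)

rank<binom : ∀ P → rank P < binom (length P) (trues P)
rank<binom [] = s≤s z≤n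
rank<binom (true ∷ P) = <-≤-trans (rank<binom P) (m≤m+n _ _)
rank<binom (false ∷ P) with trues P | rank<binom P
... | zero  | r< = r<
... | suc r | r< = +-monoʳ-< (binom (length P) r) r<

unrank-rank : ∀ P → unrank (length P) (trues P) (rank P) ≡ P
unrank-rank [] = refl
unrank-rank (true ∷ P) with rank P <? binom (length P) (trues P)
... | yes _ = cong (true ∷_) (unrank-rank P)
... | no r≮ = ⊥-elim (r≮ (rank<binom P))
unrank-rank (false ∷ P) with trues P | rank<binom P | unrank-rank P
... | zero  | _ | eq = cong (false ∷_) eq
... | suc r | _ | eq with binom (length P) r + rank P <? binom (length P) r
...   | yes lt = ⊥-elim (<⇒≱ lt (m≤m+n _ _))
...   | no _ rewrite m+n∸m≡n (binom (length P) r) (rank P) = cong (false ∷_) eq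

record IsForest (k j v m : ℕ) (F : List (List ℕ)) : Set where
  field
    size     : length F ≡ suc j
    nonEmpty : All NonEmpty F
    stirling : All Stirling F
    disjoint : AllPairs Disjoint F
    content  : Content k v m (concat F)

IsForest-above : ∀ {k j v m F} → IsForest k j (suc v) m F → All (Above v) F
IsForest-above {F = F} forest = All.map
  (λ w⊆F {_} x∈w → Content-≥ (IsForest.content forest) (Sublist.Any-resp-⊆ w⊆F x∈w))
  (Sublist.all⊆concat F)

IsForest-∌ : ∀ {k j v m F} → IsForest k j (suc v) m F → All (v ∉_) F
IsForest-∌ forest = All.map Above⇒∉ (IsForest-above forest)

All-++⁻₃ : ∀ {A : Set} {Q : A → Set} pre {xs post} → All Q (pre ++ xs ++ post) →
  All Q pre × All Q xs × All Q post
All-++⁻₃ pre {xs} qs = let qPre , qRest = All.++⁻ pre qs in qPre , All.++⁻ xs qRest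

AllPairs-++⁻ : ∀ {A : Set} {R : A → A → Set} xs {ys} → AllPairs R (xs ++ ys) →
  AllPairs R xs × AllPairs R ys × All (λ x → All (R x) ys) xs
AllPairs-++⁻ [] rs = [] , rs , []
AllPairs-++⁻ (x ∷ xs) (r ∷ rs) =
  let rxs , rys , cross = AllPairs-++⁻ xs rs
  in All.++⁻ˡ xs r ∷ rxs , rys , All.++⁻ʳ xs r ∷ cross

All-swap : ∀ {A B : Set} {R : A → B → Set} {xs ys} →
  All (λ x → All (R x) ys) xs → All (λ y → All (λ x → R x y) xs) ys
All-swap {ys = []} _ = []
All-swap {ys = y ∷ ys} rs = All.map All.head rs ∷ All-swap (All.map All.tail rs)

Disjoint-sources : ∀ {v : ℕ} {W q xs} → (∀ {x} → x ∈ W → x ≡ v ⊎ Any (x ∈_) xs) → v ∉ q →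
  All (λ s → Disjoint s q) xs → Disjoint W q
Disjoint-sources src v∉q xs∩q (x∈W , x∈q) with src x∈W
... | inj₁ refl = v∉q x∈q
... | inj₂ i = uncurry (λ s∩q x∈s → s∩q (x∈s , x∈q)) (All.lookupAny xs∩q i)

AllPairs-replace : ∀ {v W} pre xs post → (∀ {x} → x ∈ W → x ≡ v ⊎ Any (x ∈_) xs) →
  All (v ∉_) pre → All (v ∉_) post → AllPairs Disjoint (pre ++ xs ++ post) →
  AllPairs Disjoint (pre ++ W ∷ post)
AllPairs-replace {v} {W} pre xs post src v∉pre v∉post disj
  with AllPairs-++⁻ pre disj
... | disjPre , disjRest , cross with AllPairs-++⁻ xs disjRest
... | _ , disjPost , xs∩post =
  AllPairsₚ.++⁺ disjPre (W∩post ∷ disjPost) (All.zipWith withPre (v∉pre , cross))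
  where
  W∩post : All (Disjoint W) post
  W∩post = All.zipWith (uncurry (Disjoint-sources src)) (v∉post , All-swap xs∩post)

  withPre : ∀ {p} → v ∉ p × All (Disjoint p) (xs ++ post) → All (Disjoint p) (W ∷ post)
  withPre (v∉p , p∩rest) =
    Disjointₚ.sym (Disjoint-sources src v∉p (All.map Disjointₚ.sym (All.++⁻ˡ xs p∩rest)))
    ∷ All.++⁻ʳ xs p∩rest

AllPairs-expand : ∀ pre {w} xs post → All (_⊆ w) xs → AllPairs Disjoint xs →
  AllPairs Disjoint (pre ++ w ∷ post) → AllPairs Disjoint (pre ++ xs ++ post)
AllPairs-expand pre {w} xs post xs⊆w disjXs disj
  with AllPairs-++⁻ pre disj
... | disjPre , w∩post ∷ disjPost , cross =
  AllPairsₚ.++⁺ disjPre (AllPairsₚ.++⁺ disjXs disjPost (All.map (λ s⊆w → All.map (shrinkˡ s⊆w) w∩post) xs⊆w))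
    (All.map withPre cross)
  where
  shrinkˡ : ∀ {s q : List ℕ} → s ⊆ w → Disjoint w q → Disjoint s q
  shrinkˡ s⊆w w∩q (x∈s , x∈q) = w∩q (Sublist.Any-resp-⊆ s⊆w x∈s , x∈q)
  shrinkʳ : ∀ {p s : List ℕ} → Disjoint p w → s ⊆ w → Disjoint p s
  shrinkʳ p∩w s⊆w (x∈p , x∈s) = p∩w (x∈p , Sublist.Any-resp-⊆ s⊆w x∈s)
  withPre : ∀ {p} → All (Disjoint p) (w ∷ post) → All (Disjoint p) (xs ++ post)
  withPre (p∩w ∷ p∩post) = All.++⁺ (All.map (shrinkʳ p∩w) xs⊆w) p∩post

v∈joinWith : ∀ v ss → 2 ≤ length ss → v ∈ joinWith v ss
v∈joinWith v (s ∷ t ∷ ss) _ = ∈-++⁺ʳ s (here refl)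
v∈joinWith v (s ∷ []) (s≤s ())

v∈joinWith-scatter : ∀ {k v} → 1 ≤ k → ∀ P xs → length P ≡ suc k → v ∈ joinWith v (scatter P xs)
v∈joinWith-scatter {v = v} 1≤k P xs lenP =
  v∈joinWith v (scatter P xs) (subst (2 ≤_) (sym (trans (length-scatter P xs) lenP)) (s≤s 1≤k))

countAll-middle : ∀ x pre w post →
  countAll x (pre ++ w ∷ post) ≡ countAll x pre + (count x w + countAll x post)
countAll-middle x pre w post = trans (countAll-++ x pre (w ∷ post)) (cong (countAll x pre +_) (countAll-∷ x w post))

countAll-block : ∀ x pre xs post →
  countAll x (pre ++ xs ++ post) ≡ countAll x pre + (countAll x xs + countAll x post)
countAll-block x pre xs post = trans (countAll-++ x pre (xs ++ post)) (cong (countAll x pre +_) (countAll-++ x xs post))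

countAll-joinBlock-≢ : ∀ {x v} P pre xs post → length xs ≡ trues P → x ≢ v →
  countAll x (pre ++ joinWith v (scatter P xs) ∷ post) ≡ countAll x (pre ++ xs ++ post)
countAll-joinBlock-≢ {x} {v} P pre xs post len x≢v = begin
  countAll x (pre ++ joinWith v (scatter P xs) ∷ post)
    ≡⟨ countAll-middle x pre _ post ⟩
  countAll x pre + (count x (joinWith v (scatter P xs)) + countAll x post)
    ≡⟨ cong (λ n → countAll x pre + (n + countAll x post))
         (trans (count-joinWith-≢ (scatter P xs) x≢v) (countAll-scatter x P xs len)) ⟩
  countAll x pre + (countAll x xs + countAll x post)
    ≡⟨ countAll-block x pre xs post ⟨
  countAll x (pre ++ xs ++ post) ∎
  where open ≡-Reasoning

countAll-joinBlock-≡ : ∀ v P pre xs post → length xs ≡ trues P → All (v ∉_) xs →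
  countAll v (pre ++ joinWith v (scatter P xs) ∷ post) ≡ countAll v pre + (pred (length P) + countAll v post)
countAll-joinBlock-≡ v P pre xs post len v∉xs = begin
  countAll v (pre ++ joinWith v (scatter P xs) ∷ post)
    ≡⟨ countAll-middle v pre _ post ⟩
  countAll v pre + (count v (joinWith v (scatter P xs)) + countAll v post)
    ≡⟨ cong (λ n → countAll v pre + (n + countAll v post)) separators ⟩
  countAll v pre + (pred (length P) + countAll v post) ∎
  where
  open ≡-Reasoning
  separators : count v (joinWith v (scatter P xs)) ≡ pred (length P)
  separators = begin
    count v (joinWith v (scatter P xs))                       ≡⟨ count-joinWith-≡ v (scatter P xs) ⟩
    countAll v (scatter P xs) + pred (length (scatter P xs))  ≡⟨ cong₂ _+_ (countAll-scatter v P xs len)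
                                                                          (cong pred (length-scatter P xs)) ⟩
    countAll v xs + pred (length P)                           ≡⟨ cong (_+ pred (length P)) (countAll-∉ xs v∉xs) ⟩
    pred (length P)                                           ∎

insert : ℕ → List Bool → ℕ → List (List ℕ) → List (List ℕ)
insert v P t F =
  take t F ++ joinWith v (scatter P (take (trues P) (drop t F))) ∷ drop (t + trues P) F

take-length-++ : ∀ {A : Set} (xs ys : List A) → take (length xs) (xs ++ ys) ≡ xs
take-length-++ [] ys = refl
take-length-++ (x ∷ xs) ys = cong (x ∷_) (take-length-++ xs ys)

drop-length-++ : ∀ {A : Set} (xs ys : List A) → drop (length xs) (xs ++ ys) ≡ ys
drop-length-++ [] ys = refl
drop-length-++ (x ∷ xs) ys = drop-length-++ xs ys

insert-block : ∀ v P pre xs post → length xs ≡ trues P →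
  insert v P (length pre) (pre ++ xs ++ post) ≡ pre ++ joinWith v (scatter P xs) ∷ post
insert-block v P pre xs post len
  rewrite take-length-++ pre (xs ++ post) | drop-length-++ pre (xs ++ post) | sym len
        | take-length-++ xs post | sym (drop-drop (length pre) (length xs) (pre ++ xs ++ post))
        | drop-length-++ pre (xs ++ post) | drop-length-++ xs post = refl

blocks : ∀ {A : Set} t r (F : List A) → t + r ≤ length F →
  ∃₂ λ pre xs → ∃ λ post → F ≡ pre ++ xs ++ post × length pre ≡ t × length xs ≡ r
blocks zero zero F _ = [] , [] , F , refl , refl , refl
blocks zero (suc r) (x ∷ F) (s≤s le) with blocks zero r F le
... | [] , xs , post , refl , _ , len = [] , x ∷ xs , post , refl , refl , cong suc len
blocks (suc t) r (x ∷ F) (s≤s le) with blocks t r F le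
... | pre , xs , post , refl , lenPre , lenXs = x ∷ pre , xs , post , refl , cong suc lenPre , lenXs

-- The position arithmetic of a block of r words between t words and p words,
-- in a list of j + 1 words before and j + r words after the insertion.
block-arith : ∀ t r p → t + (r + p) ≡ (t + p) + r
block-arith t r p = trans (cong (t +_) (+-comm r p)) (sym (+-assoc t p r))

position-arith : ∀ t r p j → t + (r + p) ≡ j + r → t + suc p ≡ suc j
position-arith t r p j eq =
  trans (+-suc t p) (cong suc (+-cancelʳ-≡ r (t + p) j (trans (sym (block-arith t r p)) eq)))

height-arith : ∀ t r p j → t + suc p ≡ suc j → t + (r + p) ≡ j + r
height-arith t r p j eq =
  trans (block-arith t r p) (cong (_+ r) (suc-injective (trans (sym (+-suc t p)) eq)))

IsForest-insert : ∀ {k j j′ v m} → 1 ≤ k → ∀ P pre xs post →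
  IsForest k j′ (suc v) (suc m) (pre ++ xs ++ post) → length xs ≡ trues P → length P ≡ suc k →
  length pre + suc (length post) ≡ suc j →
  IsForest k j v (suc (suc m)) (pre ++ joinWith v (scatter P xs) ∷ post)
IsForest-insert {k} {v = v} 1≤k P pre xs post forest len-xs len-P position = record
  { size     = trans (length-++ pre) position
  ; nonEmpty = All.++⁺ (proj₁ ne) (∈⇒NonEmpty v∈W ∷ proj₂ (proj₂ ne))
  ; stirling = All.++⁺ (proj₁ st) (stirlingW ∷ proj₂ (proj₂ st))
  ; disjoint = AllPairs-replace pre xs post letters v∉pre v∉post disjoint
  ; content  = Content-extend (λ x x≢v → countAll-joinBlock-≢ P pre xs post len-xs x≢v) copies content
  }
  where
  open IsForest forest
  W = joinWith v (scatter P xs)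

  ne : All NonEmpty pre × All NonEmpty xs × All NonEmpty post
  ne = All-++⁻₃ pre nonEmpty
  st : All Stirling pre × All Stirling xs × All Stirling post
  st = All-++⁻₃ pre stirling
  above : All (Above v) pre × All (Above v) xs × All (Above v) post
  above = All-++⁻₃ pre (IsForest-above forest)
  v∉pre : All (v ∉_) pre
  v∉pre = All.map Above⇒∉ (proj₁ above)
  v∉xs : All (v ∉_) xs
  v∉xs = All.map Above⇒∉ (proj₁ (proj₂ above))
  v∉post : All (v ∉_) post
  v∉post = All.map Above⇒∉ (proj₂ (proj₂ above))
  disjointXs : AllPairs Disjoint xs
  disjointXs = proj₁ (AllPairs-++⁻ xs (proj₁ (proj₂ (AllPairs-++⁻ pre disjoint))))

  v∈W : v ∈ W
  v∈W = v∈joinWith-scatter 1≤k P xs len-P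

  letters : ∀ {x} → x ∈ W → x ≡ v ⊎ Any (x ∈_) xs
  letters x∈W = Sum.map₂ (Any-scatter⁻ P xs) (∈-joinWith⁻ v (scatter P xs) x∈W)

  stirlingW : Stirling W
  stirlingW = Stirling-joinWith v (scatter P xs)
    (All-scatter P xs Stirling-[] (proj₁ (proj₂ st)))
    (All-scatter P xs (λ ()) (proj₁ (proj₂ above)))
    (AllPairs-scatter P xs (λ _ → λ { (() , _) }) (λ _ → λ { (_ , ()) }) disjointXs)

  copies : countAll v (pre ++ W ∷ post) ≡ k
  copies = begin
    countAll v (pre ++ W ∷ post)                             ≡⟨ countAll-joinBlock-≡ v P pre xs post len-xs v∉xs ⟩
    countAll v pre + (pred (length P) + countAll v post)    ≡⟨ cong₂ (λ a b → a + (pred (length P) + b))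
                                                                  (countAll-∉ pre v∉pre) (countAll-∉ post v∉post) ⟩
    pred (length P) + 0                                      ≡⟨ +-identityʳ _ ⟩
    pred (length P)                                          ≡⟨ cong pred len-P ⟩
    k                                                        ∎
    where open ≡-Reasoning

isolated : ∀ {v : ℕ} pre {w post} → v ∈ w → AllPairs Disjoint (pre ++ w ∷ post) →
  All (v ∉_) pre × All (v ∉_) post
isolated pre v∈w disj with AllPairs-++⁻ pre disj
... | _ , w∩post ∷ _ , cross =
  All.map (λ p∩rest v∈p → All.head p∩rest (v∈p , v∈w)) cross ,
  All.map (λ w∩q v∈q → w∩q (v∈w , v∈q)) w∩post

∈-concat-split : ∀ {x : ℕ} F → x ∈ concat F → ∃₂ λ pre w → ∃ λ post → F ≡ pre ++ w ∷ post × x ∈ w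
∈-concat-split F x∈ with ∈-concat⁻′ F x∈
... | w , x∈w , w∈F with ∈-∃++ w∈F
...   | pre , post , refl = pre , w , post , refl , x∈w

∈-concat⇒length : ∀ {x : ℕ} F → x ∈ concat F → length F ≡ suc (pred (length F))
∈-concat⇒length (_ ∷ _) _ = refl

smallest-occurs : ∀ {k v m w} → 1 ≤ k → Content k v (suc m) w → v ∈ w
smallest-occurs {v = v} {w = w} 1≤k cw = count≢0⇒∈ w (λ c≡0 → <⇒≢ 1≤k (sym (trans
  (sym (Content.inside cw v ≤-refl (m<m+n v (s≤s z≤n)))) c≡0)))

record Removal (k j v m : ℕ) (F : List (List ℕ)) : Set where
  field
    pre xs post : List (List ℕ)
    gaps        : List Bool
    height      : ℕ
    F≡          : F ≡ pre ++ joinWith v (scatter gaps xs) ∷ post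
    smaller     : IsForest k height (suc v) m (pre ++ xs ++ post)
    blockLength : length xs ≡ trues gaps
    gapCount    : length gaps ≡ suc k
    position    : length pre + suc (length post) ≡ suc j
    heightStep  : suc height ≡ j + trues gaps

removal-at : ∀ {k j v m} → 1 ≤ k → ∀ pre w post → v ∈ w → IsForest k j v (suc (suc m)) (pre ++ w ∷ post) →
  Removal k j v (suc m) (pre ++ w ∷ post)
removal-at {k} {j} {v} {m} 1≤k pre w post v∈w forest = record
  { pre = pre ; xs = xs ; post = post ; gaps = P ; height = pred (length F′)
  ; F≡ = cong (λ u → pre ++ u ∷ post) w≡join
  ; smaller = record
    { size     = size′
    ; nonEmpty = All.++⁺ (proj₁ ne) (All.++⁺ (nonEmpties-NonEmpty segs) (All.tail (proj₂ ne)))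
    ; stirling = All.++⁺ (proj₁ st) (All.++⁺ (All-nonEmpties segs stirlingSegs) (All.tail (proj₂ st)))
    ; disjoint = AllPairs-expand pre xs post (All-nonEmpties segs segs⊆w)
                   (AllPairs-nonEmpties segs (factors-disjoint v w stirlingW w≥v)) disjoint
    ; content  = content′
    }
  ; blockLength = length-nonEmpties segs
  ; gapCount    = trans (length-map nonEmpty? segs) (trans (length-factors v w) (cong suc copies))
  ; position    = trans (sym (length-++ pre)) size
  ; heightStep  = heightStep′
  }
  where
  open IsForest forest
  segs = factors v w
  P = map nonEmpty? segs
  xs = nonEmpties segs
  F′ = pre ++ xs ++ post
  ne : All NonEmpty pre × All NonEmpty (w ∷ post)
  ne = All.++⁻ pre nonEmpty
  st : All Stirling pre × All Stirling (w ∷ post)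
  st = All.++⁻ pre stirling
  stirlingW : Stirling w
  stirlingW = All.head (proj₂ st)
  v∉pre : All (v ∉_) pre
  v∉pre = proj₁ (isolated pre v∈w disjoint)
  v∉post : All (v ∉_) post
  v∉post = proj₂ (isolated pre v∈w disjoint)

  w≡join : w ≡ joinWith v (scatter P xs)
  w≡join = sym (trans (cong (joinWith v) (scatter-nonEmpties segs)) (joinWith-factors v w))

  segs⊆w : All (_⊆ w) segs
  segs⊆w = subst (λ u → All (_⊆ u) segs) (joinWith-factors v w) (joinWith-⊇ v segs)

  stirlingSegs : All Stirling segs
  stirlingSegs = All.map (λ s⊆w {_} {_} → Stirling-⊆ s⊆w stirlingW) segs⊆w

  w≥v : ∀ {x} → x ∈ w → v ≤ x
  w≥v x∈w = Content-≥ content (Sublist.Any-resp-⊆ (All.head (All.++⁻ʳ pre (Sublist.all⊆concat (pre ++ w ∷ post)))) x∈w)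

  copies : count v w ≡ k
  copies = begin
    count v w                                          ≡⟨ +-identityʳ _ ⟨
    count v w + 0                                      ≡⟨ cong₂ (λ a b → a + (count v w + b)) (countAll-∉ pre v∉pre) (countAll-∉ post v∉post) ⟨
    countAll v pre + (count v w + countAll v post)    ≡⟨ countAll-middle v pre w post ⟨
    countAll v (pre ++ w ∷ post)                      ≡⟨ Content.inside content v ≤-refl (m<m+n v (s≤s z≤n)) ⟩
    k                                                  ∎
    where open ≡-Reasoning

  content′ : Content k (suc v) (suc m) (concat F′)
  content′ = Content-shrink
    (λ x x≢v → trans (cong (countAll x) (cong (λ u → pre ++ u ∷ post) w≡join))
                     (countAll-joinBlock-≢ P pre xs post (length-nonEmpties segs) x≢v))
    (trans (countAll-block v pre xs post) (cong₂ _+_ (countAll-∉ pre v∉pre)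
      (cong₂ _+_ (countAll-∉ xs (All-nonEmpties segs (factors-∉ v w))) (countAll-∉ post v∉post))))
    content

  size′ : length F′ ≡ suc (pred (length F′))
  size′ = ∈-concat⇒length F′ (smallest-occurs 1≤k content′)

  heightStep′ : suc (pred (length F′)) ≡ j + trues P
  heightStep′ = trans (sym size′) (trans lengths
    (height-arith (length pre) (trues P) (length post) j (trans (sym (length-++ pre)) size)))
    where
    lengths : length F′ ≡ length pre + (trues P + length post)
    lengths = trans (length-++ pre)
      (cong (length pre +_) (trans (length-++ xs) (cong (_+ length post) (length-nonEmpties segs))))

removal : ∀ {k j v m} F → 1 ≤ k → IsForest k j v (suc (suc m)) F → Removal k j v (suc m) F
removal F 1≤k forest with ∈-concat-split F (smallest-occurs 1≤k (IsForest.content forest))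
... | pre , w , post , refl , v∈w = removal-at 1≤k pre w post v∈w forest

middle-unique : ∀ {v : ℕ} pre₁ pre₂ {W₁ W₂ post₁ post₂} → All (v ∉_) pre₁ → All (v ∉_) pre₂ →
  v ∈ W₁ → v ∈ W₂ → pre₁ ++ W₁ ∷ post₁ ≡ pre₂ ++ W₂ ∷ post₂ →
  pre₁ ≡ pre₂ × W₁ ≡ W₂ × post₁ ≡ post₂
middle-unique [] [] _ _ _ _ refl = refl , refl , refl
middle-unique [] (p ∷ pre₂) _ (v∉p ∷ _) v∈W₁ _ refl = ⊥-elim (v∉p v∈W₁)
middle-unique (p ∷ pre₁) [] (v∉p ∷ _) _ _ v∈W₂ refl = ⊥-elim (v∉p v∈W₂)
middle-unique (p ∷ pre₁) (p′ ∷ pre₂) (_ ∷ v∉₁) (_ ∷ v∉₂) v∈W₁ v∈W₂ eq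
  with ∷-injective eq
... | refl , eq′ with middle-unique pre₁ pre₂ v∉₁ v∉₂ v∈W₁ v∈W₂ eq′
...   | refl , refl , refl = refl , refl , refl

factors-joinWith-scatter : ∀ v P xs → 1 ≤ length P → All (v ∉_) xs →
  factors v (joinWith v (scatter P xs)) ≡ scatter P xs
factors-joinWith-scatter v P xs 1≤len v∉xs
  with scatter P xs | length-scatter P xs | All-scatter P xs (λ ()) v∉xs
... | s ∷ ss | _ | v∉ss = factors-joinWith v s ss v∉ss
... | [] | len | _ = ⊥-elim (<⇒≢ 1≤len len)

joinWith-scatter-injective : ∀ {v} P₁ P₂ xs₁ xs₂ → 1 ≤ length P₁ → 1 ≤ length P₂ →
  length xs₁ ≡ trues P₁ → length xs₂ ≡ trues P₂ → All NonEmpty xs₁ → All NonEmpty xs₂ →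
  All (v ∉_) xs₁ → All (v ∉_) xs₂ →
  joinWith v (scatter P₁ xs₁) ≡ joinWith v (scatter P₂ xs₂) → P₁ ≡ P₂ × xs₁ ≡ xs₂
joinWith-scatter-injective {v} P₁ P₂ xs₁ xs₂ len₁ len₂ lx₁ lx₂ ne₁ ne₂ v∉₁ v∉₂ eq =
  trans (sym (shape-scatter P₁ xs₁ lx₁ ne₁)) (trans (cong (map nonEmpty?) same) (shape-scatter P₂ xs₂ lx₂ ne₂)) ,
  trans (sym (nonEmpties-scatter P₁ xs₁ lx₁ ne₁)) (trans (cong nonEmpties same) (nonEmpties-scatter P₂ xs₂ lx₂ ne₂))
  where
  same : scatter P₁ xs₁ ≡ scatter P₂ xs₂
  same = trans (sym (factors-joinWith-scatter v P₁ xs₁ len₁ v∉₁))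
    (trans (cong (factors v) eq) (factors-joinWith-scatter v P₂ xs₂ len₂ v∉₂))

insert-injective : ∀ {k j₁ j₂ v m₁ m₂} → 1 ≤ k → ∀ P₁ P₂ t₁ t₂ F₁ F₂ →
  IsForest k j₁ (suc v) m₁ F₁ → IsForest k j₂ (suc v) m₂ F₂ →
  length P₁ ≡ suc k → length P₂ ≡ suc k → t₁ + trues P₁ ≤ length F₁ → t₂ + trues P₂ ≤ length F₂ →
  insert v P₁ t₁ F₁ ≡ insert v P₂ t₂ F₂ → P₁ ≡ P₂ × t₁ ≡ t₂ × F₁ ≡ F₂
insert-injective {v = v} 1≤k P₁ P₂ t₁ t₂ F₁ F₂ forest₁ forest₂ lenP₁ lenP₂ fits₁ fits₂ eq
  with blocks t₁ (trues P₁) F₁ fits₁ | blocks t₂ (trues P₂) F₂ fits₂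
... | pre₁ , xs₁ , post₁ , refl , refl , lx₁ | pre₂ , xs₂ , post₂ , refl , refl , lx₂
  with All-++⁻₃ pre₁ {xs₁} (IsForest-∌ forest₁) | All-++⁻₃ pre₂ {xs₂} (IsForest-∌ forest₂)
     | All-++⁻₃ pre₁ {xs₁} (IsForest.nonEmpty forest₁) | All-++⁻₃ pre₂ {xs₂} (IsForest.nonEmpty forest₂)
... | v∉pre₁ , v∉xs₁ , _ | v∉pre₂ , v∉xs₂ , _ | _ , ne₁ , _ | _ , ne₂ , _
  with middle-unique pre₁ pre₂ v∉pre₁ v∉pre₂
         (v∈joinWith-scatter 1≤k P₁ xs₁ lenP₁) (v∈joinWith-scatter 1≤k P₂ xs₂ lenP₂)
         (trans (sym (insert-block v P₁ pre₁ xs₁ post₁ lx₁)) (trans eq (insert-block v P₂ pre₂ xs₂ post₂ lx₂)))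
... | refl , eqW , refl
  with joinWith-scatter-injective P₁ P₂ xs₁ xs₂
         (subst (1 ≤_) (sym lenP₁) (s≤s z≤n)) (subst (1 ≤_) (sym lenP₂) (s≤s z≤n))
         lx₁ lx₂ ne₁ ne₂ v∉xs₁ v∉xs₂ eqW
... | refl , refl = refl , refl , refl

∈-replicate⁻ : ∀ {x y : ℕ} n → x ∈ replicate n y → x ≡ y
∈-replicate⁻ (suc n) (here x≡y) = x≡y
∈-replicate⁻ (suc n) (there x∈) = ∈-replicate⁻ n x∈

IsForest-single : ∀ {k} v → 1 ≤ k → IsForest k 0 v 1 [ replicate k v ]
IsForest-single {suc k} v _ = record
  { size     = refl
  ; nonEmpty = refl ∷ []
  ; stirling = stirling ∷ []
  ; disjoint = [] ∷ []
  ; content  = Content-interval (suc k) v 1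
  }
  where
  stirling : Stirling (replicate (suc k) v)
  stirling y<x τ = <⇒≢ y<x
    (trans (∈-replicate⁻ (suc k) (head∈ (Sublist.∷ˡ⁻ τ))) (sym (∈-replicate⁻ (suc k) (head∈ τ))))

single-letter : ∀ {k j v F} → IsForest k j v 1 F → ∀ {x} → x ∈ concat F → x ≡ v
single-letter {v = v} forest {x} x∈ with x <? v + 1
... | yes x<v+1 = ≤-antisym (≤-pred (subst (x <_) (+-comm v 1) x<v+1)) (Content-≥ (IsForest.content forest) x∈)
... | no x≮v+1 = ⊥-elim (∈⇒count≢0 x∈ (Content.above (IsForest.content forest) x (≮⇒≥ x≮v+1)))

all-equal : ∀ {v} w → (∀ {x} → x ∈ w → x ≡ v) → w ≡ replicate (count v w) v
all-equal [] _ = refl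
all-equal (y ∷ w) only-v with only-v (here refl)
... | refl = trans (cong (y ∷_) (all-equal w (only-v ∘ there)))
                   (cong (λ n → replicate n y) (sym (count-∷-≡ w refl)))

IsForest-single-unique : ∀ {k j v F} → IsForest k j v 1 F → F ≡ [ replicate k v ] × j ≡ 0
IsForest-single-unique {F = []} forest with IsForest.size forest
... | ()
IsForest-single-unique {k} {v = v} {F = w ∷ []} forest =
  cong [_] (trans (all-equal w (λ x∈w → single-letter forest (∈-++⁺ˡ x∈w))) (cong (λ n → replicate n v) copies)) ,
  sym (suc-injective (IsForest.size forest))
  where
  copies : count v w ≡ k
  copies = trans (sym (countAll-[ v ] w)) (Content.inside (IsForest.content forest) v ≤-refl (m<m+n v (s≤s z≤n)))
IsForest-single-unique {F = [] ∷ _ ∷ _} forest with IsForest.nonEmpty forest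
... | () ∷ _
IsForest-single-unique {F = (_ ∷ _) ∷ [] ∷ _} forest with IsForest.nonEmpty forest
... | _ ∷ () ∷ _
IsForest-single-unique {v = v} {F = (y ∷ w₁) ∷ (z ∷ w₂) ∷ G} forest with IsForest.disjoint forest
... | (w₁∩w₂ ∷ _) ∷ _ = ⊥-elim (w₁∩w₂ (here (sym y≡v) , here (sym z≡v)))
  where
  y≡v : y ≡ v
  y≡v = single-letter forest (here refl)
  z≡v : z ≡ v
  z≡v = single-letter forest (∈-++⁺ʳ (y ∷ w₁) (here refl))

label : ∀ {k} → ℕ → Step k → Label k
label j (a i) = aL j i
label j b = bL j
label j c = cL j

data Moves {k : ℕ} : ℕ → Step k → ℕ → Set where
  rise  : ∀ {j} (i : Fin k) → Moves j (a i) (j + suc (toℕ i))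
  fall  : ∀ {j} → Moves (suc j) b j
  level : ∀ {j} → Moves j c j

Diagram : ∀ k → ℕ → List (Step k) → List ℕ → Set
Diagram k j [] [] = j ≡ 0
Diagram k j (st ∷ u) (x ∷ s) = x < pos k (label j st) × ∃ λ j′ → Moves j st j′ × Diagram k j′ u s
Diagram k j [] (_ ∷ _) = ⊥
Diagram k j (_ ∷ _) [] = ⊥

total : ∀ {k} → List (Step k) → ℤ
total u = foldr ℤ._+_ (ℤ.+ 0) (map Δ u)

Admissible : ∀ {k} → ℤ → List (Step k) → Set
Admissible y u = All (ℤ.+ 0 ℤ.≤_) (scanl ℤ._+_ y (map Δ u)) × (y ℤ.+ total u ≡ ℤ.+ 0)

Fits : ∀ k → List ℕ → List (Label k) → Set
Fits k = Pointwise (λ x v → x < pos k v)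

toDiagram : ∀ {k} j {y} u s → y ≡ ℤ.+ j → Admissible y u → Fits k s (labelFrom y u) → Diagram k j u s
toDiagram j [] [] refl (_ , end) [] = trans (sym (+-identityʳ j)) (ℤ.+-injective end)
toDiagram j (a i ∷ u) (x ∷ s) refl (_ ∷ nonneg , end) (x< ∷ fits) =
  x< , _ , rise i , toDiagram _ u s refl (nonneg , trans (ℤ.+-assoc (ℤ.+ j) (Δ (a i)) (total u)) end) fits
toDiagram zero (b ∷ u) (x ∷ s) refl (_ ∷ () ∷ _ , _) _
toDiagram (suc j) (b ∷ u) (x ∷ s) refl (_ ∷ nonneg , end) (x< ∷ fits) =
  x< , j , fall , toDiagram j u s refl (nonneg , trans (ℤ.+-assoc (ℤ.+ suc j) -[1+ 0 ] (total u)) end) fits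
toDiagram j (c ∷ u) (x ∷ s) refl (_ ∷ nonneg , end) (x< ∷ fits) =
  x< , j , level , toDiagram j u s (ℤ.+-identityʳ (ℤ.+ j)) (nonneg , trans (ℤ.+-assoc (ℤ.+ j) (ℤ.+ 0) (total u)) end) fits

fromDiagram : ∀ {k} j {y} u s → y ≡ ℤ.+ j → Diagram k j u s → Admissible y u × Fits k s (labelFrom y u)
fromDiagram j [] [] refl refl = (ℤ.+≤+ z≤n ∷ [] , refl) , []
fromDiagram j (a i ∷ u) (x ∷ s) refl (x< , _ , rise .i , d) =
  let (nonneg , end) , fits = fromDiagram _ u s refl d
  in (ℤ.+≤+ z≤n ∷ nonneg , trans (sym (ℤ.+-assoc (ℤ.+ j) (Δ (a i)) (total u))) end) , x< ∷ fits
fromDiagram (suc j) (b ∷ u) (x ∷ s) refl (x< , _ , fall , d) =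
  let (nonneg , end) , fits = fromDiagram j u s refl d
  in (ℤ.+≤+ z≤n ∷ nonneg , trans (sym (ℤ.+-assoc (ℤ.+ suc j) -[1+ 0 ] (total u))) end) , x< ∷ fits
fromDiagram j (c ∷ u) (x ∷ s) refl (x< , _ , level , d) =
  let (nonneg , end) , fits = fromDiagram j u s (ℤ.+-identityʳ (ℤ.+ j)) d
  in (ℤ.+≤+ z≤n ∷ nonneg , trans (sym (ℤ.+-assoc (ℤ.+ j) (ℤ.+ 0) (total u))) end) , x< ∷ fits

IsPathDiagram⇒Diagram : ∀ {k n} u s → IsPathDiagram k n (u , s) → length u ≡ n × Diagram k 0 u s
IsPathDiagram⇒Diagram u s (len , (nonneg , end) , fits) =
  len , toDiagram 0 u s refl (nonneg , trans (ℤ.+-identityˡ (total u)) end) fits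

Diagram⇒IsPathDiagram : ∀ {k n} u s → length u ≡ n → Diagram k 0 u s → IsPathDiagram k n (u , s)
Diagram⇒IsPathDiagram u s len d =
  let (nonneg , end) , fits = fromDiagram 0 u s refl d
  in len , (nonneg , trans (sym (ℤ.+-identityˡ (total u))) end) , fits

-- The number of nonempty gaps of the word created by a step: a fall closes
-- a word, a level step keeps one, and the rise a_ℓ spreads ℓ + 1 words.
pieces : ∀ {k} → Step k → ℕ
pieces (a i) = suc (suc (toℕ i))
pieces b = 0
pieces c = 1

pieces-injective : ∀ {k} (st st′ : Step k) → pieces st ≡ pieces st′ → st ≡ st′
pieces-injective (a i) (a i′) eq = cong a (toℕ-injective (suc-injective (suc-injective eq)))
pieces-injective b b _ = refl
pieces-injective c c _ = refl
pieces-injective (a _) b ()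
pieces-injective (a _) c ()
pieces-injective b (a _) ()
pieces-injective c (a _) ()
pieces-injective b c ()
pieces-injective c b ()

stepWithPieces : ∀ {k} r → r ≤ suc k → ∃ λ (st : Step k) → pieces st ≡ r
stepWithPieces zero _ = b , refl
stepWithPieces (suc zero) _ = c , refl
stepWithPieces (suc (suc ℓ)) (s≤s ℓ<k) = a (fromℕ< ℓ<k) , cong (suc ∘ suc) (toℕ-fromℕ< ℓ<k)

nextHeight : ∀ {k} → ℕ → Step k → ℕ
nextHeight j st = pred (j + pieces st)

Moves⇒pieces : ∀ {k j j′} {st : Step k} → Moves j st j′ → suc j′ ≡ j + pieces st
Moves⇒pieces {j = j} (rise i) = sym (+-suc j (suc (toℕ i)))
Moves⇒pieces {j = suc j} fall = cong suc (sym (+-identityʳ j))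
Moves⇒pieces {j = j} level = sym (+-comm j 1)

Moves⇒nextHeight : ∀ {k j j′} {st : Step k} → Moves j st j′ → j′ ≡ nextHeight j st
Moves⇒nextHeight moves = cong pred (Moves⇒pieces moves)

pieces⇒Moves : ∀ {k} j (st : Step k) j′ → suc j′ ≡ j + pieces st → Moves j st j′
pieces⇒Moves j (a i) j′ eq =
  subst (Moves j (a i)) (suc-injective (trans (sym (+-suc j (suc (toℕ i)))) (sym eq))) (rise i)
pieces⇒Moves zero b j′ ()
pieces⇒Moves (suc j) b j′ eq = subst (Moves (suc j) b) (trans (sym (+-identityʳ j)) (suc-injective (sym eq))) fall
pieces⇒Moves j c j′ eq = subst (Moves j c) (suc-injective (trans (+-comm 1 j) (sym eq))) level

-- The possibility function counts the choices of the nonempty gaps among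
-- the k + 1 gaps of the new word, times the j + 1 positions in the forest.
pos≡ : ∀ {k} j (st : Step k) → pos k (label j st) ≡ binom (suc k) (pieces st) * suc j
pos≡ {k} j (a i) = cong (_* suc j) (sym (binom≡C (suc k) (pieces (a i))))
pos≡ j b = sym (+-identityʳ (suc j))
pos≡ {k} j c = cong (λ z → suc z * suc j) (sym (trans (binom≡C k 1) (nC1≡n k)))

gapsOf : ∀ {k} → ℕ → Step k → ℕ → List Bool
gapsOf {k} j st x = unrank (suc k) (pieces st) (x / suc j)

positionOf : ℕ → ℕ → ℕ
positionOf j x = x % suc j

quotient< : ∀ {k} j (st : Step k) x → x < pos k (label j st) → x / suc j < binom (suc k) (pieces st)
quotient< j st x x< = m<n*o⇒m/o<n (subst (x <_) (pos≡ j st) x<)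

gapsOf-valid : ∀ {k} j (st : Step k) x → x < pos k (label j st) →
  length (gapsOf j st x) ≡ suc k × trues (gapsOf j st x) ≡ pieces st
gapsOf-valid {k} j st x x< =
  length-unrank (suc k) (pieces st) (x / suc j) , trues-unrank (suc k) (pieces st) (x / suc j) (quotient< j st x x<)

code-injective : ∀ {k} j (st st′ : Step k) x x′ → x < pos k (label j st) → x′ < pos k (label j st′) →
  gapsOf j st x ≡ gapsOf j st′ x′ → positionOf j x ≡ positionOf j x′ → st ≡ st′ × x ≡ x′
code-injective {k} j st st′ x x′ x< x′< sameGaps samePosition
  with pieces-injective st st′ (trans (sym (proj₂ (gapsOf-valid j st x x<)))
         (trans (cong trues sameGaps) (proj₂ (gapsOf-valid j st′ x′ x′<))))
... | refl = refl , (begin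
  x                                  ≡⟨ m≡m%n+[m/n]*n x (suc j) ⟩
  x % suc j + (x / suc j) * suc j    ≡⟨ cong₂ (λ p q → p + q * suc j) samePosition sameQuotient ⟩
  x′ % suc j + (x′ / suc j) * suc j  ≡⟨ m≡m%n+[m/n]*n x′ (suc j) ⟨
  x′                                 ∎)
  where
  open ≡-Reasoning
  sameQuotient : x / suc j ≡ x′ / suc j
  sameQuotient = trans (sym (rank-unrank (suc k) (pieces st) (x / suc j) (quotient< j st x x<)))
    (trans (cong rank sameGaps) (rank-unrank (suc k) (pieces st) (x′ / suc j) (quotient< j st x′ x′<)))

code-surjective : ∀ {k} j P t → length P ≡ suc k → t < suc j →
  ∃₂ λ (st : Step k) x → x < pos k (label j st) × gapsOf j st x ≡ P × positionOf j x ≡ t × pieces st ≡ trues P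
code-surjective {k} j P t lenP t<
  with stepWithPieces (trues P) (subst (trues P ≤_) lenP (trues≤length P))
... | st , piecesSt = st , x , x< , gapsEq , positionEq , piecesSt
  where
  x : ℕ
  x = t + rank P * suc j

  positionEq : x % suc j ≡ t
  positionEq = trans ([m+kn]%n≡m%n t (rank P) (suc j)) (m<n⇒m%n≡m t<)

  quotientEq : x / suc j ≡ rank P
  quotientEq = *-cancelʳ-≡ (x / suc j) (rank P) (suc j) (+-cancelˡ-≡ t _ _
    (trans (sym (cong (_+ (x / suc j) * suc j) positionEq)) (sym (m≡m%n+[m/n]*n x (suc j)))))

  gapsEq : gapsOf j st x ≡ P
  gapsEq = begin
    unrank (suc k) (pieces st) (x / suc j)  ≡⟨ cong₂ (unrank (suc k)) piecesSt quotientEq ⟩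
    unrank (suc k) (trues P) (rank P)       ≡⟨ cong (λ n → unrank n (trues P) (rank P)) lenP ⟨
    unrank (length P) (trues P) (rank P)    ≡⟨ unrank-rank P ⟩
    P                                        ∎
    where open ≡-Reasoning

  x< : x < pos k (label j st)
  x< = subst (x <_) (sym (pos≡ j st)) (begin-strict
    t + rank P * suc j              <⟨ +-monoˡ-< (rank P * suc j) t< ⟩
    suc (rank P) * suc j            ≤⟨ *-monoˡ-≤ (suc j) (subst (λ n → rank P < binom n (trues P)) lenP (rank<binom P)) ⟩
    binom (suc k) (trues P) * suc j ≡⟨ cong (λ r → binom (suc k) r * suc j) piecesSt ⟨
    binom (suc k) (pieces st) * suc j ∎)
    where open ≤-Reasoning

height-code : ∀ {k j j′} (st : Step k) x → x < pos k (label j st) → Moves j st j′ →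
  suc j′ ≡ j + trues (gapsOf j st x)
height-code {j = j} st x x< moves = trans (Moves⇒pieces moves) (cong (j +_) (sym (proj₂ (gapsOf-valid j st x x<))))

blockFits : ∀ {t j r len} → t < suc j → len ≡ j + r → t + r ≤ len
blockFits {r = r} t< len≡ = subst (_ + r ≤_) (sym len≡) (+-monoˡ-≤ r (≤-pred t<))

code-fits : ∀ {k j j′ v m F} (st : Step k) x → x < pos k (label j st) → Moves j st j′ →
  IsForest k j′ v m F → positionOf j x + trues (gapsOf j st x) ≤ length F
code-fits {j = j} st x x< moves forest =
  blockFits (m%n<n x (suc j)) (trans (IsForest.size forest) (height-code st x x< moves))

IsForest-insertAt : ∀ {k j j′ v m} → 1 ≤ k → ∀ P t F → IsForest k j′ (suc v) (suc m) F →
  length P ≡ suc k → t < suc j → suc j′ ≡ j + trues P → IsForest k j v (suc (suc m)) (insert v P t F)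
IsForest-insertAt {j = j} {v = v} 1≤k P t F forest lenP t< height
  with blocks t (trues P) F (blockFits t< (trans (IsForest.size forest) height))
... | pre , xs , post , refl , refl , lenXs rewrite insert-block v P pre xs post lenXs =
  IsForest-insert 1≤k P pre xs post forest lenXs lenP
    (position-arith (length pre) (trues P) (length post) j (trans lengths (trans (IsForest.size forest) height)))
  where
  lengths : length pre + (trues P + length post) ≡ length (pre ++ xs ++ post)
  lengths = sym (trans (length-++ pre) (cong (length pre +_) (trans (length-++ xs) (cong (_+ length post) lenXs))))

-- The forest of a path diagram from height j with smallest letter v: read
-- the diagram from its end, inserting the letters … , v + 1, v.
forestOf : ∀ {k} → ℕ → ℕ → List (Step k) → List ℕ → List (List ℕ)
forestOf {k} j v [] _ = [ replicate k v ]
forestOf j v (_ ∷ _) [] = []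
forestOf j v (st ∷ u) (x ∷ s) =
  insert v (gapsOf j st x) (positionOf j x) (forestOf (nextHeight j st) (suc v) u s)

forestOf-IsForest : ∀ {k} → 1 ≤ k → ∀ m j v u s → length u ≡ m → Diagram k j u s →
  IsForest k j v (suc m) (forestOf j v u s)
forestOf-IsForest 1≤k zero j v [] [] _ refl = IsForest-single v 1≤k
forestOf-IsForest 1≤k (suc m) j v (st ∷ u) (x ∷ s) len (x< , j′ , moves , d)
  with Moves⇒nextHeight moves
... | refl = IsForest-insertAt 1≤k (gapsOf j st x) (positionOf j x) _
  (forestOf-IsForest 1≤k m j′ (suc v) u s (suc-injective len) d)
  (proj₁ (gapsOf-valid j st x x<)) (m%n<n x (suc j)) (height-code st x x< moves)

forestOf-injective : ∀ {k} → 1 ≤ k → ∀ j v u s u′ s′ → length u ≡ length u′ →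
  Diagram k j u s → Diagram k j u′ s′ → forestOf j v u s ≡ forestOf j v u′ s′ → u ≡ u′ × s ≡ s′
forestOf-injective 1≤k j v [] [] [] [] _ _ _ _ = refl , refl
forestOf-injective 1≤k j v (st ∷ u) (x ∷ s) (st′ ∷ u′) (x′ ∷ s′) len
  (x< , j₁ , moves , d) (x′< , j₂ , moves′ , d′) eq
  with Moves⇒nextHeight moves | Moves⇒nextHeight moves′
... | refl | refl
  with forestOf-IsForest 1≤k (length u) j₁ (suc v) u s refl d
     | forestOf-IsForest 1≤k (length u) j₂ (suc v) u′ s′ (sym (suc-injective len)) d′
... | forest | forest′
  with insert-injective 1≤k (gapsOf j st x) (gapsOf j st′ x′) (positionOf j x) (positionOf j x′) _ _
         forest forest′ (proj₁ (gapsOf-valid j st x x<)) (proj₁ (gapsOf-valid j st′ x′ x′<))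
         (code-fits st x x< moves forest) (code-fits st′ x′ x′< moves′ forest′) eq
... | sameGaps , samePosition , sameForest
  with code-injective j st st′ x x′ x< x′< sameGaps samePosition
... | refl , refl with forestOf-injective 1≤k j₁ (suc v) u s u′ s′ (suc-injective len) d d′ sameForest
... | refl , refl = refl , refl

forestOf-surjective : ∀ {k} → 1 ≤ k → ∀ m j v F → IsForest k j v (suc m) F →
  ∃₂ λ u s → length u ≡ m × Diagram k j u s × forestOf j v u s ≡ F
forestOf-surjective 1≤k zero j v F forest with IsForest-single-unique forest
... | refl , refl = [] , [] , refl , refl , refl
forestOf-surjective 1≤k (suc m) j v F forest with removal F 1≤k forest
... | record { pre = pre ; xs = xs ; post = post ; gaps = P ; height = j′ ; F≡ = refl ; smaller = smaller
             ; blockLength = lenXs ; gapCount = lenP ; position = position ; heightStep = heightStep }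
  with code-surjective j P (length pre) lenP
         (s≤s (subst (length pre ≤_) (suc-injective (trans (sym (+-suc (length pre) (length post))) position))
                     (m≤m+n (length pre) (length post))))
... | st , x , x< , gapsEq , positionEq , piecesEq
  with pieces⇒Moves j st j′ (trans heightStep (cong (j +_) (sym piecesEq)))
... | moves with forestOf-surjective 1≤k m j′ (suc v) _ smaller | Moves⇒nextHeight moves
... | u , s , len , d , forestEq | refl =
  st ∷ u , x ∷ s , cong suc len , (x< , j′ , moves , d) , decoded
  where
  decoded : forestOf j v (st ∷ u) (x ∷ s) ≡ pre ++ joinWith v (scatter P xs) ∷ post
  decoded rewrite forestEq | gapsEq | positionEq = insert-block v P pre xs post lenXs

height0-single : ∀ {k v m F} → IsForest k 0 v m F → F ≡ [ concat F ]
height0-single {F = w ∷ []} _ = cong [_] (sym (++-identityʳ w))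
height0-single {F = []} forest with IsForest.size forest
... | ()
height0-single {F = _ ∷ _ ∷ _} forest with IsForest.size forest
... | ()

IsStirlingPerm⇒IsForest : ∀ {k n w} → 1 ≤ k → IsStirlingPerm k (suc n) w → IsForest k 0 1 (suc n) [ w ]
IsStirlingPerm⇒IsForest {k} {n} {w} 1≤k (w↭multiset , condition) = record
  { size     = refl
  ; nonEmpty = ∈⇒NonEmpty (smallest-occurs 1≤k content) ∷ []
  ; stirling = StirlingCondition⇒Stirling w condition ∷ []
  ; disjoint = [] ∷ []
  ; content  = subst (Content k 1 (suc n)) (sym (++-identityʳ w)) content
  }
  where
  content : Content k 1 (suc n) w
  content = Content-resp (λ x → sym (↭⇒count≡ w↭multiset x)) (Content-multiset k (suc n))

IsForest⇒IsStirlingPerm : ∀ {k n F} → IsForest k 0 1 (suc n) F → IsStirlingPerm k (suc n) (concat F)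
IsForest⇒IsStirlingPerm {k} {n} {F} forest =
  count≡⇒↭ (concat F) (multiset k (suc n)) (Content-count content (Content-multiset k (suc n))) ,
  Stirling⇒StirlingCondition (concat F) (All.head (subst (All Stirling) (height0-single forest) stirling))
  where open IsForest forest

module _ {k n : ℕ} (1≤k : 1 ≤ k) where

  diagramForest : PathDiagram k n → List (List ℕ)
  diagramForest ((u , s) , _) = forestOf 0 1 u s

  diagramForest-IsForest : ∀ d → IsForest k 0 1 (suc n) (diagramForest d)
  diagramForest-IsForest ((u , s) , diagram) =
    let len , d = IsPathDiagram⇒Diagram u s diagram in forestOf-IsForest 1≤k n 0 1 u s len d

  diagramForest-injective : ∀ d d′ → diagramForest d ≡ diagramForest d′ → proj₁ d ≡ proj₁ d′
  diagramForest-injective ((u , s) , diagram) ((u′ , s′) , diagram′) eq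
    with IsPathDiagram⇒Diagram u s diagram | IsPathDiagram⇒Diagram u′ s′ diagram′
  ... | len , d | len′ , d′ with forestOf-injective 1≤k 0 1 u s u′ s′ (trans len (sym len′)) d d′ eq
  ... | refl , refl = refl

  decode : PathDiagram k n → StirlingPerm k (suc n)
  decode d = concat (diagramForest d) , IsForest⇒IsStirlingPerm (diagramForest-IsForest d)

  encode : (σ : StirlingPerm k (suc n)) → Σ (PathDiagram k n) λ d → diagramForest d ≡ [ proj₁ σ ]
  encode (w , perm) with forestOf-surjective 1≤k n 0 1 [ w ] (IsStirlingPerm⇒IsForest 1≤k perm)
  ... | u , s , len , d , eq = ((u , s) , Diagram⇒IsPathDiagram u s len d) , eq

  stirling↔pathDiagram : Inverse (StirlingSetoid k (suc n)) (PathDiagramSetoid k n)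
  stirling↔pathDiagram = record
    { to        = proj₁ ∘ encode
    ; from      = decode
    ; to-cong   = λ {σ} {τ} σ≡τ → diagramForest-injective (proj₁ (encode σ)) (proj₁ (encode τ))
                    (trans (proj₂ (encode σ)) (trans (cong [_] σ≡τ) (sym (proj₂ (encode τ)))))
    ; from-cong = λ d≡d′ → cong (λ p → concat (forestOf 0 1 (proj₁ p) (proj₂ p))) d≡d′
    ; inverse   = (λ {d} {σ} → encode-decode {d} {σ}) , (λ {σ} {d} → decode-encode {σ} {d})
    }
    where
    encode-decode : ∀ {d σ} → proj₁ σ ≡ proj₁ (decode d) → proj₁ (proj₁ (encode σ)) ≡ proj₁ d
    encode-decode {d} {σ} σ≡ = diagramForest-injective (proj₁ (encode σ)) d
      (trans (proj₂ (encode σ)) (trans (cong [_] σ≡) (sym (height0-single (diagramForest-IsForest d)))))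

    decode-encode : ∀ {σ d} → proj₁ d ≡ proj₁ (proj₁ (encode σ)) → proj₁ (decode d) ≡ proj₁ σ
    decode-encode {σ} {d} d≡ = trans (cong (λ p → concat (forestOf 0 1 (proj₁ p) (proj₂ p))) d≡)
      (trans (cong concat (proj₂ (encode σ))) (++-identityʳ (proj₁ σ)))

theorem4 : (k n : ℕ) → 1 ≤ k →
    Bijection (StirlingSetoid k (suc n)) (PathDiagramSetoid k n)
theorem4 k n 1≤k = Inverse⇒Bijection (stirling↔pathDiagram 1≤k)
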